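{- Let $k, c, r$ be integers such that $k \geq 1$, $r \geq 2k+3$, $r \equiv 1 \pmod 2$, $c \equiv 1 \pmod 3$ and $\frac{3(k-2)(k-1)}{2} \leq c \leq \frac{3k(k-1)}{2}$. Then there exists an $(r,c)$-circulant.
   Context: All graphs are finite and simple. For a vertex $v$, $e(v)$ denotes the number of edges of the subgraph induced by the open neighbourhood of $v$. An $(r,c)$-graph is an $r$-regular graph with $e(v) = c$ for every vertex $v$. For $n \geq 2$ and $S \subseteq \{1, \dots, \lfloor n/2 \rfloor\}$, $\mathsf{Circ}(n,S)$ is the Cayley graph of $\mathbb{Z}_n$ with connection set $S \cup -S$. An $(r,c)$-circulant is a graph $\mathsf{Circ}(n,S)$ (for some $n$, $S$) that is an $(r,c)$-graph. -}

module Defs where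

open import Data.Nat using (ℕ; _+_; _*_; _≤_; _<_)
open import Data.Nat.Properties using (_≟_; _<?_)
open import Data.Fin using (Fin; toℕ)
open import Data.List using (List; length; filter; cartesianProduct)
open import Data.List.Relation.Unary.Any using (Any; any?)
open import Data.List.Relation.Unary.All using (All)
open import Data.List.Base using (allFin)
open import Data.Product using (_×_; proj₁; proj₂; _,_)
open import Data.Sum using (_⊎_)
open import Relation.Binary.PropositionalEquality using (_≡_)
open import Relation.Nullary using (Dec)
open import Relation.Nullary.Decidable using (_⊎-dec_; _×-dec_)

ValidConnSet : ℕ → List ℕ → Set
ValidConnSet n S = All (λ s → 1 ≤ s × 2 * s ≤ n) S

-- y ≡ x + s (mod n) for vertices x y of ℤ_n (=Fin n) and 0 ≤ s < n.
PlusMod : (n : ℕ) → Fin n → ℕ → Fin n → Set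
PlusMod n x s y = (toℕ x + s ≡ toℕ y) ⊎ (toℕ x + s ≡ toℕ y + n)

plusMod? : (n : ℕ) (x : Fin n) (s : ℕ) (y : Fin n) → Dec (PlusMod n x s y)
plusMod? n x s y = (toℕ x + s ≟ toℕ y) ⊎-dec (toℕ x + s ≟ toℕ y + n)

Adj : (n : ℕ) → List ℕ → Fin n → Fin n → Set
Adj n S x y = Any (λ s → PlusMod n x s y ⊎ PlusMod n y s x) S

adj? : (n : ℕ) (S : List ℕ) (x y : Fin n) → Dec (Adj n S x y)
adj? n S x y = any? (λ s → plusMod? n x s y ⊎-dec plusMod? n y s x) S

degree : (n : ℕ) → List ℕ → Fin n → ℕ
degree n S v = length (filter (adj? n S v) (allFin n))

NbhdEdge : (n : ℕ) → List ℕ → Fin n → Fin n × Fin n → Set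
NbhdEdge n S v p =
  (toℕ (proj₁ p) < toℕ (proj₂ p)) × (Adj n S v (proj₁ p) × (Adj n S v (proj₂ p) × Adj n S (proj₁ p) (proj₂ p)))

nbhdEdge? : (n : ℕ) (S : List ℕ) (v : Fin n) (p : Fin n × Fin n) → Dec (NbhdEdge n S v p)
nbhdEdge? n S v (x , y) = (toℕ x <? toℕ y) ×-dec (adj? n S v x ×-dec (adj? n S v y ×-dec adj? n S x y))

e : (n : ℕ) → List ℕ → Fin n → ℕ
e n S v = length (filter (nbhdEdge? n S v) (cartesianProduct (allFin n) (allFin n)))

IsRCGraph : ℕ → ℕ → (n : ℕ) → List ℕ → Set
IsRCGraph r c n S = (v : Fin n) → degree n S v ≡ r × e n S v ≡ c

ExistsRCCirculant : ℕ → ℕ → Set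
ExistsRCCirculant r c =
  Data.Product.Σ ℕ λ n → Data.Product.Σ (List ℕ) λ S → (2 ≤ n) × (ValidConnSet n S × IsRCGraph r c n S)

-- The circulant is Circ(12B, {6B, 4B} ∪ U) for a set U ⊆ [1, B) of positive integers.  Its
-- symmetric connection set is C = {4B, 6B, 8B} ∪ U ∪ (12B − U), so r = |C| = 3 + 2|U|, and
-- 2 e(v) counts the pairs (a, b) ∈ C² with b − a ∈ C.  The residues 4B, 6B, 8B only interact
-- with each other (the triangle 0, 4B, 8B), while differences of elements of ±U fall back into
-- ±U exactly along the Schur triples u + w = v of U, so e(v) = 1 + 3 σ(U), σ(U) counting the
-- ordered pairs of U whose sum lies in U.  The set U = {p+1, …, 2p} ∪ Q·({1, …, j} ∪ {x}) with
-- Q = 4(p+1) has |U| = p + j + 1, its first block takes part in no Schur triple, and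
-- σ(U) = C(j, 2) + (2j + 1 − x), which covers every c allowed by the hypotheses.

module Submission where

open import Defs
open import Data.Empty using (⊥-elim)
open import Data.Fin using (toℕ)
open import Data.Fin.Properties using (toℕ<n)
open import Data.List using (List; []; _∷_; _++_; [_]; map; length; filter; upTo; allFin; tabulate; applyUpTo; cartesianProduct)
open import Data.List.Properties
  using (length-map; length-++; length-applyUpTo; map-++; map-∘; map-id; map-cong-local; map-tabulate; map-upTo; applyUpTo-∷ʳ;
         filter-++; filter-all; filter-none; filter-accept; filter-reject)
open import Data.List.Membership.Propositional using (_∈_; _∉_; find; lose)
open import Data.List.Membership.Propositional.Properties
  using (∈-map⁺; ∈-map⁻; ∈-filter⁺; ∈-filter⁻; ∈-upTo⁺; ∈-upTo⁻; ∈-applyUpTo⁺; ∈-applyUpTo⁻;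
         ∈-cartesianProduct⁺; ∈-cartesianProduct⁻; ∈-++⁺ˡ; ∈-++⁺ʳ; ∈-++⁻)
open import Data.List.Membership.Propositional.Properties.WithK using (unique∧set⇒bag)
open import Data.List.Relation.Binary.BagAndSetEquality using (∼bag⇒↭)
open import Data.List.Relation.Binary.Permutation.Propositional.Properties using (↭-length)
open import Data.List.Relation.Unary.All as All using (All; []; _∷_)
open import Data.List.Relation.Unary.AllPairs using ([]; _∷_)
open import Data.List.Relation.Unary.Any as Any using (Any; any?; here; there)
open import Data.List.Relation.Unary.Unique.Propositional using (Unique)
import Data.List.Relation.Unary.Unique.Propositional.Properties as Unique
open import Data.Nat
  using (ℕ; zero; suc; pred; _+_; _*_; _∸_; _≤_; _<_; _%_; _/_; _⊓_; z≤n; s≤s; NonZero; ∣_-_∣)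
open import Data.Nat.Base using (>-nonZero; >-nonZero⁻¹)
open import Data.Nat.Combinatorics using (nC1≡n; nCk+nC[k+1]≡[n+1]C[k+1]) renaming (_C_ to _choose_)
open import Data.Nat.DivMod
  using (m≡m%n+[m/n]*n; m%n<n; m<n⇒m%n≡m; m%n%n≡m%n; %-distribˡ-+; [m+n]%n≡m%n; [m+kn]%n≡m%n;
         m≤n⇒[n∸m]%m≡n%m; n%n≡0; m*n%n≡0; m%n*o≡m*o%[n*o])
open import Data.Nat.ListAction using (sum)
open import Data.Nat.ListAction.Properties using (sum-++)
open import Data.Nat.Properties
open import Algebra.Properties.CommutativeSemigroup +-commutativeSemigroup using (x∙yz≈y∙xz; interchange)
open import Data.List.Membership.DecPropositional _≟_ using (_∈?_)
open import Data.Nat.Tactic.RingSolver using (solve-∀)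
open import Data.Product using (_×_; _,_; proj₁; proj₂; swap; ∃-syntax)
open import Data.Sum using (_⊎_; inj₁; inj₂)
import Data.Sum as Sum
open import Data.Unit using (tt)
open import Function.Base using (_∘_)
open import Function.Bundles using (_⇔_; mk⇔; Equivalence)
open import Level using (0ℓ)
open import Relation.Binary.PropositionalEquality hiding ([_])
open import Relation.Nullary using (Dec; yes; no; ¬_; ¬?)
open import Relation.Nullary.Decidable using (_⊎-dec_; _×-dec_)
open import Relation.Unary using (Pred; Decidable)

private
  variable
    A B : Set

-- Counting in lists

count : {P : Pred A 0ℓ} → Decidable P → List A → ℕ
count P? xs = length (filter P? xs)

∑ : List A → (A → ℕ) → ℕ
∑ xs f = sum (map f xs)

syntax ∑ xs (λ x → e) = ∑[ x ∈ xs ] e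

Unique-map⁺ : {xs : List A} (f : A → B) (g : B → A) →
  (∀ {x} → x ∈ xs → g (f x) ≡ x) → Unique xs → Unique (map f xs)
Unique-map⁺ {xs = xs} f g g∘f xs! = Unique.map⁻ (subst Unique (sym map-g∘f) xs!)
  where
  map-g∘f : map g (map f xs) ≡ xs
  map-g∘f = trans (sym (map-∘ xs)) (trans (map-cong-local (All.tabulate g∘f)) (map-id xs))

module _ {xs : List A} {ys : List B} (f : A → B) (g : B → A)
         (f∈ : ∀ {x} → x ∈ xs → f x ∈ ys) (g∈ : ∀ {y} → y ∈ ys → g y ∈ xs)
         (g∘f : ∀ {x} → x ∈ xs → g (f x) ≡ x) (f∘g : ∀ {y} → y ∈ ys → f (g y) ≡ y) where

  length-bijection : Unique xs → Unique ys → length xs ≡ length ys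
  length-bijection xs! ys! = trans (sym (length-map f xs))
    (↭-length (∼bag⇒↭ (unique∧set⇒bag (Unique-map⁺ f g g∘f xs!) ys! (mk⇔ to from))))
    where
    to : ∀ {y} → y ∈ map f xs → y ∈ ys
    to y∈ with ∈-map⁻ f y∈
    ... | x , x∈ , refl = f∈ x∈
    from : ∀ {y} → y ∈ ys → y ∈ map f xs
    from y∈ = subst (_∈ map f xs) (f∘g y∈) (∈-map⁺ f (g∈ y∈))

module _ {P : Pred A 0ℓ} (P? : Decidable P) where

  count-cong : {Q : Pred A 0ℓ} (Q? : Decidable Q) (xs : List A) →
    (∀ {x} → x ∈ xs → P x ⇔ Q x) → count P? xs ≡ count Q? xs
  count-cong Q? [] _ = refl
  count-cong Q? (x ∷ xs) P⇔Q with P? x | Q? x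
  ... | yes _  | yes _  = cong suc (count-cong Q? xs (P⇔Q ∘ there))
  ... | yes px | no ¬qx = ⊥-elim (¬qx (Equivalence.to (P⇔Q (here refl)) px))
  ... | no ¬px | yes qx = ⊥-elim (¬px (Equivalence.from (P⇔Q (here refl)) qx))
  ... | no _   | no _   = count-cong Q? xs (P⇔Q ∘ there)

  count-bijection : {Q : Pred B 0ℓ} (Q? : Decidable Q) {xs : List A} {ys : List B} →
    Unique xs → Unique ys → (f : A → B) (g : B → A) →
    (∀ {x} → x ∈ xs → P x → f x ∈ ys × Q (f x)) →
    (∀ {y} → y ∈ ys → Q y → g y ∈ xs × P (g y)) →
    (∀ {x} → x ∈ xs → P x → g (f x) ≡ x) →
    (∀ {y} → y ∈ ys → Q y → f (g y) ≡ y) →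
    count P? xs ≡ count Q? ys
  count-bijection Q? xs! ys! f g f∈ g∈ g∘f f∘g =
    length-bijection f g (maps-into f∈ P? Q?) (maps-into g∈ Q? P?) (inverse-on g∘f P?) (inverse-on f∘g Q?)
      (Unique.filter⁺ P? xs!) (Unique.filter⁺ Q? ys!)
    where
    maps-into : ∀ {C D : Set} {R : Pred C 0ℓ} {R′ : Pred D 0ℓ} {zs ws} {h : C → D} →
      (∀ {z} → z ∈ zs → R z → h z ∈ ws × R′ (h z)) → (R? : Decidable R) (R′? : Decidable R′) →
      ∀ {z} → z ∈ filter R? zs → h z ∈ filter R′? ws
    maps-into h∈ R? R′? z∈ =
      let z∈zs , Rz = ∈-filter⁻ R? z∈ ; hz∈ , R′hz = h∈ z∈zs Rz in ∈-filter⁺ R′? hz∈ R′hz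
    inverse-on : ∀ {C : Set} {R : Pred C 0ℓ} {zs} {h : C → C} →
      (∀ {z} → z ∈ zs → R z → h z ≡ z) → (R? : Decidable R) → ∀ {z} → z ∈ filter R? zs → h z ≡ z
    inverse-on eq R? z∈ = let z∈zs , Rz = ∈-filter⁻ R? z∈ in eq z∈zs Rz

  count-++ : (xs ys : List A) → count P? (xs ++ ys) ≡ count P? xs + count P? ys
  count-++ xs ys = trans (cong length (filter-++ P? xs ys)) (length-++ (filter P? xs))

  count-map : (f : B → A) (xs : List B) → count P? (map f xs) ≡ count (P? ∘ f) xs
  count-map f [] = refl
  count-map f (x ∷ xs) with P? (f x)
  ... | yes _ = cong suc (count-map f xs)
  ... | no _  = count-map f xs

  count-none : (xs : List A) → (∀ {x} → x ∈ xs → ¬ P x) → count P? xs ≡ 0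
  count-none xs ¬P = cong length (filter-none P? (All.tabulate ¬P))

  count-all : (xs : List A) → (∀ {x} → x ∈ xs → P x) → count P? xs ≡ length xs
  count-all xs allP = cong length (filter-all P? (All.tabulate allP))

  count-∷-yes : ∀ {x} (xs : List A) → P x → count P? (x ∷ xs) ≡ suc (count P? xs)
  count-∷-yes xs px = cong length (filter-accept P? px)

  count-∷-no : ∀ {x} (xs : List A) → ¬ P x → count P? (x ∷ xs) ≡ count P? xs
  count-∷-no xs ¬px = cong length (filter-reject P? ¬px)

  count-complement : (xs : List A) → count P? xs + count (¬? ∘ P?) xs ≡ length xs
  count-complement [] = refl
  count-complement (x ∷ xs) with P? x
  ... | yes _ = cong suc (count-complement xs)
  ... | no _  = trans (+-suc _ _) (cong suc (count-complement xs))

  count-split : {Q : Pred A 0ℓ} (Q? : Decidable Q) (xs : List A) →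
    count P? xs ≡ count (λ x → P? x ×-dec Q? x) xs + count (λ x → P? x ×-dec ¬? (Q? x)) xs
  count-split Q? [] = refl
  count-split Q? (x ∷ xs) with P? x | Q? x
  ... | yes _ | yes _ = cong suc (count-split Q? xs)
  ... | yes _ | no _  = trans (cong suc (count-split Q? xs)) (sym (+-suc _ _))
  ... | no _  | yes _ = count-split Q? xs
  ... | no _  | no _  = count-split Q? xs

∑-++ : (xs ys : List A) (f : A → ℕ) → ∑ (xs ++ ys) f ≡ ∑ xs f + ∑ ys f
∑-++ xs ys f = trans (cong sum (map-++ f xs ys)) (sum-++ (map f xs) (map f ys))

∑-cong : (xs : List A) {f g : A → ℕ} → (∀ {x} → x ∈ xs → f x ≡ g x) → ∑ xs f ≡ ∑ xs g
∑-cong xs f≡g = cong sum (map-cong-local (All.tabulate f≡g))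

∑-+ : (xs : List A) (f g : A → ℕ) → ∑[ x ∈ xs ] (f x + g x) ≡ ∑ xs f + ∑ xs g
∑-+ [] f g = refl
∑-+ (x ∷ xs) f g = trans (cong (f x + g x +_) (∑-+ xs f g)) (interchange (f x) (g x) _ _)

∑-map : (g : A → B) (xs : List A) (f : B → ℕ) → ∑ (map g xs) f ≡ ∑[ x ∈ xs ] f (g x)
∑-map g xs f = cong sum (sym (map-∘ xs))

∑-zero : (xs : List A) {f : A → ℕ} → (∀ {x} → x ∈ xs → f x ≡ 0) → ∑ xs f ≡ 0
∑-zero [] _ = refl
∑-zero (x ∷ xs) f≡0 = cong₂ _+_ (f≡0 (here refl)) (∑-zero xs (f≡0 ∘ there))

∑-one : (xs : List A) → ∑[ x ∈ xs ] 1 ≡ length xs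
∑-one [] = refl
∑-one (x ∷ xs) = cong suc (∑-one xs)

count-cartesianProduct : {R : Pred (A × B) 0ℓ} (R? : Decidable R) (xs : List A) (ys : List B) →
  count R? (cartesianProduct xs ys) ≡ ∑[ x ∈ xs ] count (λ y → R? (x , y)) ys
count-cartesianProduct R? [] ys = refl
count-cartesianProduct R? (x ∷ xs) ys = trans (count-++ R? (map (x ,_) ys) _)
  (cong₂ _+_ (count-map R? (x ,_) ys) (count-cartesianProduct R? xs ys))

-- Arithmetic modulo n

m*n+r≢o*n : ∀ m o {n r} .{{_ : NonZero n}} → 1 ≤ r → r < n → m * n + r ≢ o * n
m*n+r≢o*n m o {n} {r} 1≤r r<n eq = <⇒≢ 1≤r (sym (begin
  r               ≡⟨ m<n⇒m%n≡m r<n ⟨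
  r % n           ≡⟨ [m+kn]%n≡m%n r m n ⟨
  (r + m * n) % n ≡⟨ cong (_% n) (trans (+-comm r (m * n)) eq) ⟩
  (o * n) % n     ≡⟨ m*n%n≡0 o n ⟩
  0               ∎))
  where open ≡-Reasoning

PlusModℕ : ℕ → ℕ → ℕ → ℕ → Set
PlusModℕ n x s y = (x + s ≡ y) ⊎ (x + s ≡ y + n)

plusMod-flip : ∀ {n x s y} → s ≤ n → PlusModℕ n y s x → PlusModℕ n x (n ∸ s) y
plusMod-flip {n} {x} {s} {y} s≤n (inj₁ y+s≡x) = inj₂ (begin
  x + (n ∸ s)     ≡⟨ cong (_+ (n ∸ s)) (sym y+s≡x) ⟩
  y + s + (n ∸ s) ≡⟨ +-assoc y s (n ∸ s) ⟩
  y + (s + (n ∸ s)) ≡⟨ cong (y +_) (m+[n∸m]≡n s≤n) ⟩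
  y + n           ∎)
  where open ≡-Reasoning
plusMod-flip {n} {x} {s} {y} s≤n (inj₂ y+s≡x+n) = inj₁ (+-cancelʳ-≡ s _ _ (begin
  x + (n ∸ s) + s ≡⟨ +-assoc x (n ∸ s) s ⟩
  x + (n ∸ s + s) ≡⟨ cong (x +_) (m∸n+n≡m s≤n) ⟩
  x + n           ≡⟨ sym y+s≡x+n ⟩
  y + s           ∎))
  where open ≡-Reasoning

module Modular (n : ℕ) .{{_ : NonZero n}} where

  infixl 6 _+ₙ_

  _+ₙ_ : ℕ → ℕ → ℕ
  x +ₙ y = (x + y) % n

  diff : ℕ → ℕ → ℕ
  diff x y = (n ∸ x) +ₙ y

  +ₙ<n : ∀ x y → x +ₙ y < n
  +ₙ<n x y = m%n<n (x + y) n

  diff<n : ∀ x y → diff x y < n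
  diff<n x y = +ₙ<n (n ∸ x) y

  %-cong-+ˡ : ∀ c {a b} → a % n ≡ b % n → (c + a) % n ≡ (c + b) % n
  %-cong-+ˡ c {a} {b} a≡b = begin
    (c + a) % n           ≡⟨ %-distribˡ-+ c a n ⟩
    (c % n + a % n) % n   ≡⟨ cong (λ z → (c % n + z) % n) a≡b ⟩
    (c % n + b % n) % n   ≡⟨ %-distribˡ-+ c b n ⟨
    (c + b) % n           ∎
    where open ≡-Reasoning

  +ₙ-assoc : ∀ x y z → x +ₙ y +ₙ z ≡ x +ₙ (y +ₙ z)
  +ₙ-assoc x y z = begin
    ((x + y) % n + z) % n ≡⟨ cong (_% n) (+-comm _ z) ⟩
    (z + (x + y) % n) % n ≡⟨ %-cong-+ˡ z (m%n%n≡m%n (x + y) n) ⟩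
    (z + (x + y)) % n     ≡⟨ cong (_% n) (trans (+-comm z _) (+-assoc x y z)) ⟩
    (x + (y + z)) % n     ≡⟨ %-cong-+ˡ x (m%n%n≡m%n (y + z) n) ⟨
    (x + (y + z) % n) % n ∎
    where open ≡-Reasoning

  ∸-+ₙ-cancel : ∀ {x} y → x ≤ n → y < n → (n ∸ x) +ₙ (x +ₙ y) ≡ y
  ∸-+ₙ-cancel {x} y x≤n y<n = begin
    (n ∸ x + (x + y) % n) % n ≡⟨ %-cong-+ˡ (n ∸ x) (m%n%n≡m%n (x + y) n) ⟩
    (n ∸ x + (x + y)) % n     ≡⟨ cong (_% n) (sym (+-assoc (n ∸ x) x y)) ⟩
    (n ∸ x + x + y) % n       ≡⟨ cong (λ z → (z + y) % n) (m∸n+n≡m x≤n) ⟩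
    (n + y) % n               ≡⟨ cong (_% n) (+-comm n y) ⟩
    (y + n) % n               ≡⟨ [m+n]%n≡m%n y n ⟩
    y % n                     ≡⟨ m<n⇒m%n≡m y<n ⟩
    y                         ∎
    where open ≡-Reasoning

  +ₙ-diff : ∀ {x y} → x ≤ n → y < n → x +ₙ diff x y ≡ y
  +ₙ-diff {x} {y} x≤n y<n = begin
    x +ₙ ((n ∸ x) +ₙ y) ≡⟨ +ₙ-assoc x (n ∸ x) y ⟨
    x +ₙ (n ∸ x) +ₙ y   ≡⟨ cong (λ z → z % n +ₙ y) (m+[n∸m]≡n x≤n) ⟩
    n % n +ₙ y          ≡⟨ cong (_+ₙ y) (n%n≡0 n) ⟩
    y % n               ≡⟨ m<n⇒m%n≡m y<n ⟩
    y                   ∎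
    where open ≡-Reasoning

  diff-unique : ∀ {x y d} → x ≤ n → d < n → x +ₙ d ≡ y → diff x y ≡ d
  diff-unique {x} {d = d} x≤n d<n refl = ∸-+ₙ-cancel d x≤n d<n

  diff-translate : ∀ v {a b} → a ≤ n → b < n → diff (v +ₙ a) (v +ₙ b) ≡ diff a b
  diff-translate v {a} {b} a≤n b<n = diff-unique (<⇒≤ (+ₙ<n v a)) (diff<n a b) (begin
    v +ₙ a +ₙ diff a b   ≡⟨ +ₙ-assoc v a (diff a b) ⟩
    v +ₙ (a +ₙ diff a b) ≡⟨ cong (v +ₙ_) (+ₙ-diff a≤n b<n) ⟩
    v +ₙ b               ∎)
    where open ≡-Reasoning

  diff-+ₙ : ∀ {x d} → x ≤ n → d < n → diff x (x +ₙ d) ≡ d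
  diff-+ₙ x≤n d<n = diff-unique x≤n d<n refl

  plusMod⇒+ₙ : ∀ {x s y} → y < n → PlusModℕ n x s y → x +ₙ s ≡ y
  plusMod⇒+ₙ y<n (inj₁ refl) = m<n⇒m%n≡m y<n
  plusMod⇒+ₙ {y = y} y<n (inj₂ eq) = trans (cong (_% n) eq) (trans ([m+n]%n≡m%n y n) (m<n⇒m%n≡m y<n))

  plusMod⇒diff : ∀ {x d y} → x < n → y < n → d < n → PlusModℕ n x d y → diff x y ≡ d
  plusMod⇒diff {x} {d} x<n y<n d<n x+d≡y = diff-unique (<⇒≤ x<n) d<n (plusMod⇒+ₙ {x} {d} y<n x+d≡y)

  +ₙ⇒plusMod : ∀ {x s y} → x < n → s < n → x +ₙ s ≡ y → PlusModℕ n x s y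
  +ₙ⇒plusMod {x} {s} x<n s<n refl with x + s <? n
  ... | yes x+s<n = inj₁ (sym (m<n⇒m%n≡m x+s<n))
  ... | no x+s≮n = inj₂ (begin
    x + s               ≡⟨ m∸n+n≡m n≤x+s ⟨
    x + s ∸ n + n       ≡⟨ cong (_+ n) (m<n⇒m%n≡m x+s∸n<n) ⟨
    (x + s ∸ n) % n + n ≡⟨ cong (_+ n) (m≤n⇒[n∸m]%m≡n%m n≤x+s) ⟩
    (x + s) % n + n     ∎)
    where
    open ≡-Reasoning
    n≤x+s : n ≤ x + s
    n≤x+s = ≮⇒≥ x+s≮n
    x+s∸n<n : x + s ∸ n < n
    x+s∸n<n = +-cancelʳ-< _ _ n (subst (_< n + n) (sym (m∸n+n≡m n≤x+s)) (+-mono-< x<n s<n))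

-- Degrees and neighbourhood edges in circulants

map-toℕ-allFin : ∀ n → map toℕ (allFin n) ≡ upTo n
map-toℕ-allFin n = trans (map-tabulate (λ i → i) toℕ) (tabulate-toℕ n)
  where
  tabulate-toℕ : ∀ n → tabulate {n = n} toℕ ≡ upTo n
  tabulate-toℕ zero = refl
  tabulate-toℕ (suc n) = cong (0 ∷_) (begin
    tabulate (suc ∘ toℕ)     ≡⟨ map-tabulate toℕ suc ⟨
    map suc (tabulate toℕ)   ≡⟨ cong (map suc) (tabulate-toℕ n) ⟩
    map suc (upTo n)         ≡⟨ map-upTo suc n ⟩
    applyUpTo suc n          ∎)
    where open ≡-Reasoning

module _ (n : ℕ) {P : Pred ℕ 0ℓ} (P? : Decidable P) where

  count-allFin : count (P? ∘ toℕ) (allFin n) ≡ count P? (upTo n)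
  count-allFin = trans (sym (count-map P? toℕ (allFin n))) (cong (count P?) (map-toℕ-allFin n))

count-allFin² : ∀ n {R : Pred (ℕ × ℕ) 0ℓ} (R? : Decidable R) →
  count (λ p → R? (toℕ (proj₁ p) , toℕ (proj₂ p))) (cartesianProduct (allFin n) (allFin n)) ≡
  count R? (cartesianProduct (upTo n) (upTo n))
count-allFin² n R? = begin
  count _ (cartesianProduct (allFin n) (allFin n))
    ≡⟨ count-cartesianProduct _ (allFin n) (allFin n) ⟩
  ∑[ x ∈ allFin n ] count (λ y → R? (toℕ x , toℕ y)) (allFin n)
    ≡⟨ ∑-cong (allFin n) (λ {x} _ → count-allFin n (λ y → R? (toℕ x , y))) ⟩
  ∑[ x ∈ allFin n ] count (λ y → R? (toℕ x , y)) (upTo n)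
    ≡⟨ ∑-map toℕ (allFin n) (λ x → count (λ y → R? (x , y)) (upTo n)) ⟨
  ∑[ x ∈ map toℕ (allFin n) ] count (λ y → R? (x , y)) (upTo n)
    ≡⟨ cong (λ xs → ∑[ x ∈ xs ] count (λ y → R? (x , y)) (upTo n)) (map-toℕ-allFin n) ⟩
  ∑[ x ∈ upTo n ] count (λ y → R? (x , y)) (upTo n)
    ≡⟨ count-cartesianProduct R? (upTo n) (upTo n) ⟨
  count R? (cartesianProduct (upTo n) (upTo n)) ∎
  where open ≡-Reasoning

-- Adj n S x y and adj? n S x y are definitionally Adjℕ n S (toℕ x) (toℕ y) and
-- adjℕ? n S (toℕ x) (toℕ y), so counts over Fin n transfer to counts over upTo n.
Adjℕ : ℕ → List ℕ → ℕ → ℕ → Set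
Adjℕ n S x y = Any (λ s → PlusModℕ n x s y ⊎ PlusModℕ n y s x) S

adjℕ? : ∀ n S x y → Dec (Adjℕ n S x y)
adjℕ? n S x y =
  any? (λ s → ((x + s ≟ y) ⊎-dec (x + s ≟ y + n)) ⊎-dec ((y + s ≟ x) ⊎-dec (y + s ≟ x + n))) S

Conn : ℕ → List ℕ → ℕ → Set
Conn n S d = Any (λ s → (d ≡ s) ⊎ (d ≡ n ∸ s)) S

conn? : ∀ n S d → Dec (Conn n S d)
conn? n S d = any? (λ s → (d ≟ s) ⊎-dec (d ≟ n ∸ s)) S

module Circulant (n : ℕ) .{{_ : NonZero n}} (S : List ℕ) (S-valid : ValidConnSet n S) where

  open Modular n public

  private
    s<n : ∀ {s} → 1 ≤ s × 2 * s ≤ n → s < n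
    s<n {s} (1≤s , 2s≤n) = <-≤-trans (m<m+n s (subst (0 <_) (sym (+-identityʳ s)) 1≤s)) 2s≤n

    n∸s<n : ∀ {s} → 1 ≤ s × 2 * s ≤ n → n ∸ s < n
    n∸s<n valid@(1≤s , _) = ∸-monoʳ-< 1≤s (<⇒≤ (s<n valid))

  adjℕ⇒conn : ∀ {x y} → x < n → y < n → Adjℕ n S x y → Conn n S (diff x y)
  adjℕ⇒conn {x} {y} x<n y<n adj =
    let s , s∈S , x~y = find adj in lose s∈S (steps (All.lookup S-valid s∈S) x~y)
    where
    steps : ∀ {s} → 1 ≤ s × 2 * s ≤ n →
      PlusModℕ n x s y ⊎ PlusModℕ n y s x → (diff x y ≡ s) ⊎ (diff x y ≡ n ∸ s)
    steps valid (inj₁ x+s≡y) = inj₁ (plusMod⇒diff x<n y<n (s<n valid) x+s≡y)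
    steps valid (inj₂ y+s≡x) = inj₂ (plusMod⇒diff x<n y<n (n∸s<n valid) (plusMod-flip (<⇒≤ (s<n valid)) y+s≡x))

  conn⇒adjℕ : ∀ {x y} → x < n → y < n → Conn n S (diff x y) → Adjℕ n S x y
  conn⇒adjℕ {x} {y} x<n y<n conn =
    let s , s∈S , d≡±s = find conn in lose s∈S (steps (All.lookup S-valid s∈S) d≡±s)
    where
    x+d≡y : x +ₙ diff x y ≡ y
    x+d≡y = +ₙ-diff (<⇒≤ x<n) y<n
    steps : ∀ {s} → 1 ≤ s × 2 * s ≤ n →
      (diff x y ≡ s) ⊎ (diff x y ≡ n ∸ s) → PlusModℕ n x s y ⊎ PlusModℕ n y s x
    steps valid (inj₁ refl) = inj₁ (+ₙ⇒plusMod x<n (s<n valid) x+d≡y)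
    steps {s} valid (inj₂ d≡n∸s) = inj₂ (subst (λ t → PlusModℕ n y t x) (m∸[m∸n]≡n (<⇒≤ (s<n valid)))
      (plusMod-flip (<⇒≤ (n∸s<n valid))
        (+ₙ⇒plusMod x<n (n∸s<n valid) (subst (λ d → x +ₙ d ≡ y) d≡n∸s x+d≡y))))

  conn-neg : ∀ {d} → Conn n S d → Conn n S (n ∸ d)
  conn-neg conn = let s , s∈S , d≡±s = find conn in lose s∈S (flip (All.lookup S-valid s∈S) d≡±s)
    where
    flip : ∀ {d s} → 1 ≤ s × 2 * s ≤ n → (d ≡ s) ⊎ (d ≡ n ∸ s) → (n ∸ d ≡ s) ⊎ (n ∸ d ≡ n ∸ s)
    flip _ (inj₁ refl) = inj₂ refl
    flip valid (inj₂ refl) = inj₁ (m∸[m∸n]≡n (<⇒≤ (s<n valid)))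

  adjℕ-sym : ∀ {x y} → Adjℕ n S x y → Adjℕ n S y x
  adjℕ-sym = Any.map Sum.swap

  ¬conn-0 : ¬ Conn n S 0
  ¬conn-0 conn with find conn
  ... | s , s∈S , inj₁ 0≡s = <⇒≢ (proj₁ (All.lookup S-valid s∈S)) 0≡s
  ... | s , s∈S , inj₂ 0≡n∸s = <⇒≢ (m<n⇒0<n∸m (s<n (All.lookup S-valid s∈S))) 0≡n∸s

  adjℕ-irrefl : ∀ {x} → x < n → ¬ Adjℕ n S x x
  adjℕ-irrefl {x} x<n adj =
    ¬conn-0 (subst (Conn n S) (diff-unique (<⇒≤ x<n) (≤-<-trans z≤n x<n) x+0≡x) (adjℕ⇒conn x<n x<n adj))
    where
    x+0≡x : x +ₙ 0 ≡ x
    x+0≡x = trans (cong (_% n) (+-identityʳ x)) (m<n⇒m%n≡m x<n)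

  Triangle : ℕ → ℕ × ℕ → Set
  Triangle v (x , y) = Adjℕ n S v x × (Adjℕ n S v y × Adjℕ n S x y)

  triangle? : ∀ v → Decidable (Triangle v)
  triangle? v (x , y) = adjℕ? n S v x ×-dec (adjℕ? n S v y ×-dec adjℕ? n S x y)

  edge? : ∀ v → Decidable (λ p → proj₁ p < proj₂ p × Triangle v p)
  edge? v p = (proj₁ p <? proj₂ p) ×-dec triangle? v p

  pairs : List (ℕ × ℕ)
  pairs = cartesianProduct (upTo n) (upTo n)

  private
    pairs! : Unique pairs
    pairs! = Unique.cartesianProduct⁺ (Unique.upTo⁺ n) (Unique.upTo⁺ n)

    pair<n : ∀ {x y} → (x , y) ∈ pairs → x < n × y < n
    pair<n xy∈ = let x∈ , y∈ = ∈-cartesianProduct⁻ (upTo n) (upTo n) xy∈ in ∈-upTo⁻ x∈ , ∈-upTo⁻ y∈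

  e≡edges : ∀ v → e n S v ≡ count (edge? (toℕ v)) pairs
  e≡edges v = count-allFin² n (edge? (toℕ v))

  edges+edges≡triangles : ∀ v → count (edge? v) pairs + count (edge? v) pairs ≡ count (triangle? v) pairs
  edges+edges≡triangles v = sym (begin
    count (triangle? v) pairs
      ≡⟨ count-split (triangle? v) (λ p → proj₁ p <? proj₂ p) pairs ⟩
    count (λ p → triangle? v p ×-dec (proj₁ p <? proj₂ p)) pairs
      + count (λ p → triangle? v p ×-dec ¬? (proj₁ p <? proj₂ p)) pairs
      ≡⟨ cong₂ _+_ (count-cong _ (edge? v) pairs (λ _ → mk⇔ swap swap)) lower≡upper ⟩
    count (edge? v) pairs + count (edge? v) pairs ∎)
    where
    open ≡-Reasoning
    lower≡upper : count (λ p → triangle? v p ×-dec ¬? (proj₁ p <? proj₂ p)) pairs ≡ count (edge? v) pairs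
    lower≡upper = count-bijection _ (edge? v) pairs! pairs! swap swap
      (λ { {x , y} xy∈ ((vx , vy , xy) , x≮y) →
           let x<n , y<n = pair<n xy∈ in
           ∈-cartesianProduct⁺ (∈-upTo⁺ y<n) (∈-upTo⁺ x<n) ,
           ≤∧≢⇒< (≮⇒≥ x≮y) (λ { refl → adjℕ-irrefl x<n xy }) , vy , vx , adjℕ-sym xy })
      (λ { {x , y} xy∈ (x<y , vx , vy , xy) →
           let x<n , y<n = pair<n xy∈ in
           ∈-cartesianProduct⁺ (∈-upTo⁺ y<n) (∈-upTo⁺ x<n) , (vy , vx , adjℕ-sym xy) , <-asym x<y })
      (λ _ _ → refl) (λ _ _ → refl)

  module _ (C : List ℕ) (C! : Unique C) (C<n : ∀ {d} → d ∈ C → d < n)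
           (C⇒conn : ∀ {d} → d ∈ C → Conn n S d) (conn⇒C : ∀ {d} → d < n → Conn n S d → d ∈ C) where

    private
      adj⇒diff∈C : ∀ {v y} → v < n → y < n → Adjℕ n S v y → diff v y ∈ C
      adj⇒diff∈C {v} {y} v<n y<n adj = conn⇒C (diff<n v y) (adjℕ⇒conn v<n y<n adj)

      C⇒adj : ∀ {v a} → v < n → a ∈ C → Adjℕ n S v (v +ₙ a)
      C⇒adj {v} {a} v<n a∈ = conn⇒adjℕ v<n (+ₙ<n v a)
        (subst (Conn n S) (sym (diff-+ₙ (<⇒≤ v<n) (C<n a∈))) (C⇒conn a∈))

    degree≡length : ∀ v → degree n S v ≡ length C
    degree≡length v = begin
      degree n S v
        ≡⟨ count-allFin n (adjℕ? n S (toℕ v)) ⟩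
      count (adjℕ? n S (toℕ v)) (upTo n)
        ≡⟨ count-bijection (adjℕ? n S (toℕ v)) (λ _ → yes tt) (Unique.upTo⁺ n) C! (diff (toℕ v)) (toℕ v +ₙ_)
             (λ y∈ adj → adj⇒diff∈C v<n (∈-upTo⁻ y∈) adj , tt)
             (λ {a} a∈ _ → ∈-upTo⁺ (+ₙ<n (toℕ v) a) , C⇒adj v<n a∈)
             (λ y∈ _ → +ₙ-diff (<⇒≤ v<n) (∈-upTo⁻ y∈))
             (λ a∈ _ → diff-+ₙ (<⇒≤ v<n) (C<n a∈)) ⟩
      count (λ _ → yes tt) C
        ≡⟨ count-all _ C (λ _ → tt) ⟩
      length C ∎
      where
      open ≡-Reasoning
      v<n : toℕ v < n
      v<n = toℕ<n v

    triangles≡differences : ∀ {v} → v < n →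
      count (triangle? v) pairs ≡ count (λ p → conn? n S (diff (proj₁ p) (proj₂ p))) (cartesianProduct C C)
    triangles≡differences {v} v<n = count-bijection (triangle? v) _ pairs! (Unique.cartesianProduct⁺ C! C!)
      (λ { (x , y) → diff v x , diff v y }) (λ { (a , b) → v +ₙ a , v +ₙ b })
      (λ { {x , y} xy∈ (vx , vy , xy) →
           let x<n , y<n = pair<n xy∈ in
           ∈-cartesianProduct⁺ (adj⇒diff∈C v<n x<n vx) (adj⇒diff∈C v<n y<n vy) ,
           subst (Conn n S) (sym (diff-translate (n ∸ v) (<⇒≤ x<n) y<n)) (adjℕ⇒conn x<n y<n xy) })
      (λ { {a , b} ab∈ conn →
           let a∈ , b∈ = ∈-cartesianProduct⁻ C C ab∈ in
           ∈-cartesianProduct⁺ (∈-upTo⁺ (+ₙ<n v a)) (∈-upTo⁺ (+ₙ<n v b)) ,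
           C⇒adj v<n a∈ , C⇒adj v<n b∈ ,
           conn⇒adjℕ (+ₙ<n v a) (+ₙ<n v b)
             (subst (Conn n S) (sym (diff-translate v (<⇒≤ (C<n a∈)) (C<n b∈))) conn) })
      (λ { {x , y} xy∈ _ → let x<n , y<n = pair<n xy∈ in
           cong₂ _,_ (+ₙ-diff (<⇒≤ v<n) x<n) (+ₙ-diff (<⇒≤ v<n) y<n) })
      (λ { {a , b} ab∈ _ → let a∈ , b∈ = ∈-cartesianProduct⁻ C C ab∈ in
           cong₂ _,_ (diff-+ₙ (<⇒≤ v<n) (C<n a∈)) (diff-+ₙ (<⇒≤ v<n) (C<n b∈)) })

    isRCGraph : ∀ c → ∑[ a ∈ C ] count (λ b → conn? n S (diff a b)) C ≡ 2 * c → IsRCGraph (length C) c n S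
    isRCGraph c ∑≡2c v = degree≡length v , *-cancelˡ-≡ (e n S v) c 2 (begin
      2 * e n S v                     ≡⟨ cong (2 *_) (e≡edges v) ⟩
      2 * count (edge? v′) pairs      ≡⟨ cong (count (edge? v′) pairs +_) (+-identityʳ _) ⟩
      count (edge? v′) pairs + count (edge? v′) pairs ≡⟨ edges+edges≡triangles v′ ⟩
      count (triangle? v′) pairs      ≡⟨ triangles≡differences (toℕ<n v) ⟩
      count (λ p → conn? n S (diff (proj₁ p) (proj₂ p))) (cartesianProduct C C)
                                      ≡⟨ count-cartesianProduct _ C C ⟩
      ∑[ a ∈ C ] count (λ b → conn? n S (diff a b)) C ≡⟨ ∑≡2c ⟩
      2 * c                           ∎)
      where
      open ≡-Reasoning
      v′ : ℕ
      v′ = toℕ v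

-- Schur triples

sums : List ℕ → ℕ → ℕ
sums U u = count (λ w → u + w ∈? U) U

dists : List ℕ → ℕ → ℕ
dists U u = count (λ w → ∣ u - w ∣ ∈? U) U

schurTriples : List ℕ → ℕ
schurTriples U = ∑[ u ∈ U ] sums U u

∑-dists : ∀ {U} → Unique U → (∀ {u} → u ∈ U → 1 ≤ u) →
  ∑[ u ∈ U ] dists U u ≡ schurTriples U + schurTriples U
∑-dists {U} U! U-pos = begin
  ∑[ u ∈ U ] dists U u
    ≡⟨ count-cartesianProduct dist? U U ⟨
  count dist? U²
    ≡⟨ count-split dist? (λ p → proj₁ p <? proj₂ p) U² ⟩
  count (λ p → dist? p ×-dec (proj₁ p <? proj₂ p)) U² + count (λ p → dist? p ×-dec ¬? (proj₁ p <? proj₂ p)) U²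
    ≡⟨ cong₂ _+_ ascending descending ⟩
  count sum? U² + count sum? U²
    ≡⟨ cong₂ _+_ (count-cartesianProduct sum? U U) (count-cartesianProduct sum? U U) ⟩
  schurTriples U + schurTriples U ∎
  where
  open ≡-Reasoning
  U² : List (ℕ × ℕ)
  U² = cartesianProduct U U
  U²! : Unique U²
  U²! = Unique.cartesianProduct⁺ U! U!
  dist? : Decidable (λ (p : ℕ × ℕ) → ∣ proj₁ p - proj₂ p ∣ ∈ U)
  dist? p = ∣ proj₁ p - proj₂ p ∣ ∈? U
  sum? : Decidable (λ (p : ℕ × ℕ) → proj₁ p + proj₂ p ∈ U)
  sum? p = proj₁ p + proj₂ p ∈? U
  ∣a-[a+b]∣≡b : ∀ a b → ∣ a - (a + b) ∣ ≡ b
  ∣a-[a+b]∣≡b a b = trans (m≤n⇒∣m-n∣≡n∸m (m≤m+n a b)) (m+n∸m≡n a b)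
  ascending : count (λ p → dist? p ×-dec (proj₁ p <? proj₂ p)) U² ≡ count sum? U²
  ascending = count-bijection _ sum? U²! U²! (λ (u , w) → u , w ∸ u) (λ (a , b) → a , a + b)
    (λ { {u , w} uw∈ (d∈ , u<w) → let u∈ , w∈ = ∈-cartesianProduct⁻ U U uw∈ in
         ∈-cartesianProduct⁺ u∈ (subst (_∈ U) (m≤n⇒∣m-n∣≡n∸m (<⇒≤ u<w)) d∈) ,
         subst (_∈ U) (sym (m+[n∸m]≡n (<⇒≤ u<w))) w∈ })
    (λ { {a , b} ab∈ a+b∈ → let a∈ , b∈ = ∈-cartesianProduct⁻ U U ab∈ in
         ∈-cartesianProduct⁺ a∈ a+b∈ , subst (_∈ U) (sym (∣a-[a+b]∣≡b a b)) b∈ , m<m+n a (U-pos b∈) })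
    (λ { {u , w} _ (_ , u<w) → cong (u ,_) (m+[n∸m]≡n (<⇒≤ u<w)) })
    (λ { {a , b} _ _ → cong (a ,_) (m+n∸m≡n a b) })
  descending : count (λ p → dist? p ×-dec ¬? (proj₁ p <? proj₂ p)) U² ≡ count sum? U²
  descending = count-bijection _ sum? U²! U²! (λ (u , w) → w , u ∸ w) (λ (a , b) → a + b , a)
    (λ { {u , w} uw∈ (d∈ , u≮w) → let u∈ , w∈ = ∈-cartesianProduct⁻ U U uw∈ in
         ∈-cartesianProduct⁺ w∈ (subst (_∈ U) (m≤n⇒∣n-m∣≡n∸m (≮⇒≥ u≮w)) d∈) ,
         subst (_∈ U) (sym (m+[n∸m]≡n (≮⇒≥ u≮w))) u∈ })
    (λ { {a , b} ab∈ a+b∈ → let a∈ , b∈ = ∈-cartesianProduct⁻ U U ab∈ in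
         ∈-cartesianProduct⁺ a+b∈ a∈ , subst (_∈ U) (sym (trans (∣-∣-comm (a + b) a) (∣a-[a+b]∣≡b a b))) b∈ ,
         ≤⇒≯ (m≤m+n a b) })
    (λ { {u , w} _ (_ , u≮w) → cong (_, w) (m+[n∸m]≡n (≮⇒≥ u≮w)) })
    (λ { {a , b} _ _ → cong (a ,_) (m+n∸m≡n a b) })

schurTriples-padding : ∀ {G V : List ℕ} →
  (∀ {g y} → g ∈ G → y ∈ G ++ V → g + y ∉ G ++ V) → (∀ {v w} → v ∈ V → w ∈ V → v + w ∉ G) →
  schurTriples (G ++ V) ≡ schurTriples V
schurTriples-padding {G} {V} isolated sums∉G = begin
  ∑[ u ∈ G ++ V ] sums (G ++ V) u
    ≡⟨ ∑-++ G V (sums (G ++ V)) ⟩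
  ∑[ g ∈ G ] sums (G ++ V) g + ∑[ v ∈ V ] sums (G ++ V) v
    ≡⟨ cong₂ _+_ (∑-zero G (λ g∈ → count-none _ (G ++ V) (isolated g∈))) (∑-cong V sums≡) ⟩
  0 + ∑[ v ∈ V ] sums V v ∎
  where
  open ≡-Reasoning
  ∈-++-¬ˡ : ∀ {x} → x ∉ G → x ∈ G ++ V → x ∈ V
  ∈-++-¬ˡ x∉G x∈ with ∈-++⁻ G x∈
  ... | inj₁ x∈G = ⊥-elim (x∉G x∈G)
  ... | inj₂ x∈V = x∈V
  sums≡ : ∀ {v} → v ∈ V → sums (G ++ V) v ≡ sums V v
  sums≡ {v} v∈ = begin
    count (λ w → v + w ∈? G ++ V) (G ++ V)
      ≡⟨ count-++ _ G V ⟩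
    count (λ w → v + w ∈? G ++ V) G + count (λ w → v + w ∈? G ++ V) V
      ≡⟨ cong₂ _+_ (count-none _ G (λ {g} g∈ → subst (_∉ G ++ V) (+-comm g v) (isolated g∈ (∈-++⁺ʳ G v∈))))
                   (count-cong _ _ V (λ w∈ → mk⇔ (∈-++-¬ˡ (sums∉G v∈ w∈)) (∈-++⁺ʳ G))) ⟩
    0 + count (λ w → v + w ∈? V) V ∎

schurTriples-scale : ∀ Q .{{_ : NonZero Q}} (P : List ℕ) → schurTriples (map (Q *_) P) ≡ schurTriples P
schurTriples-scale Q P = begin
  ∑[ v ∈ map (Q *_) P ] sums (map (Q *_) P) v
    ≡⟨ ∑-map (Q *_) P _ ⟩
  ∑[ s ∈ P ] sums (map (Q *_) P) (Q * s)
    ≡⟨ ∑-cong P (λ {s} _ → trans (count-map _ (Q *_) P) (count-cong _ _ P (λ {s′} _ → scaled s s′))) ⟩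
  ∑[ s ∈ P ] sums P s ∎
  where
  open ≡-Reasoning
  ∈-scaled : ∀ {m} → Q * m ∈ map (Q *_) P → m ∈ P
  ∈-scaled {m} Qm∈ = let m′ , m′∈ , eq = ∈-map⁻ (Q *_) Qm∈ in subst (_∈ P) (sym (*-cancelˡ-≡ m m′ Q eq)) m′∈
  scaled : ∀ s s′ → Q * s + Q * s′ ∈ map (Q *_) P ⇔ s + s′ ∈ P
  scaled s s′ rewrite sym (*-distribˡ-+ Q s s′) = mk⇔ ∈-scaled (∈-map⁺ (Q *_))

range : ℕ → List ℕ
range j = applyUpTo suc j

∈-range⁺ : ∀ {j s} → 1 ≤ s → s ≤ j → s ∈ range j
∈-range⁺ {s = suc t} _ t<j = ∈-applyUpTo⁺ suc t<j

∈-range⁻ : ∀ {j s} → s ∈ range j → 1 ≤ s × s ≤ j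
∈-range⁻ s∈ with ∈-applyUpTo⁻ suc s∈
... | t , t<j , refl = s≤s z≤n , t<j

range! : ∀ j → Unique (range j)
range! j = Unique.applyUpTo⁺₁ suc j (λ i<k _ → <⇒≢ (s≤s i<k))

range-suc : ∀ j → range (suc j) ≡ range j ++ [ suc j ]
range-suc j = sym (applyUpTo-∷ʳ suc j)

count-range-≤ : ∀ m j → count (λ s → s ≤? m) (range j) ≡ j ⊓ m
count-range-≤ m zero = refl
count-range-≤ m (suc j) = begin
  count (_≤? m) (range (suc j))                   ≡⟨ cong (count (_≤? m)) (range-suc j) ⟩
  count (_≤? m) (range j ++ [ suc j ])            ≡⟨ count-++ (_≤? m) (range j) [ suc j ] ⟩
  count (_≤? m) (range j) + count (_≤? m) [ suc j ] ≡⟨ cong (_+ count (_≤? m) [ suc j ]) (count-range-≤ m j) ⟩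
  j ⊓ m + count (_≤? m) [ suc j ]                 ≡⟨ last (suc j ≤? m) ⟩
  suc j ⊓ m                                       ∎
  where
  open ≡-Reasoning
  last : Dec (suc j ≤ m) → j ⊓ m + count (_≤? m) [ suc j ] ≡ suc j ⊓ m
  last (yes j<m) = begin
    j ⊓ m + count (_≤? m) [ suc j ] ≡⟨ cong₂ _+_ (m≤n⇒m⊓n≡m (<⇒≤ j<m)) (count-∷-yes (_≤? m) [] j<m) ⟩
    j + 1                           ≡⟨ +-comm j 1 ⟩
    suc j                           ≡⟨ m≤n⇒m⊓n≡m j<m ⟨
    suc j ⊓ m                       ∎
  last (no j≮m) = begin
    j ⊓ m + count (_≤? m) [ suc j ] ≡⟨ cong₂ _+_ (m≥n⇒m⊓n≡n m≤j) (count-∷-no (_≤? m) [] j≮m) ⟩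
    m + 0                           ≡⟨ +-identityʳ m ⟩
    m                               ≡⟨ m≥n⇒m⊓n≡n (m≤n⇒m≤1+n m≤j) ⟨
    suc j ⊓ m                       ∎
    where
    m≤j : m ≤ j
    m≤j = ≤-pred (≰⇒> j≮m)

count-range-> : ∀ {m j} → m ≤ j → count (λ s → m <? s) (range j) ≡ j ∸ m
count-range-> {m} {j} m≤j = begin
  count (m <?_) (range j)
    ≡⟨ count-cong _ _ (range j) (λ _ → mk⇔ <⇒≱ ≰⇒>) ⟩
  count (λ s → ¬? (s ≤? m)) (range j)
    ≡⟨ m+n∸m≡n (count (_≤? m) (range j)) _ ⟨
  count (_≤? m) (range j) + count (λ s → ¬? (s ≤? m)) (range j) ∸ count (_≤? m) (range j)
    ≡⟨ cong₂ _∸_ (count-complement (_≤? m) (range j)) (count-range-≤ m j) ⟩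
  length (range j) ∸ j ⊓ m
    ≡⟨ cong₂ _∸_ (length-applyUpTo suc j) (m≥n⇒m⊓n≡n m≤j) ⟩
  j ∸ m ∎
  where open ≡-Reasoning

[1+n]C2≡n+nC2 : ∀ j → suc j choose 2 ≡ j + j choose 2
[1+n]C2≡n+nC2 j = trans (sym (nCk+nC[k+1]≡[n+1]C[k+1] j 1)) (cong (_+ j choose 2) (nC1≡n j))

∑-∸-range : ∀ j → ∑[ s ∈ range j ] (j ∸ s) ≡ j choose 2
∑-∸-range zero = refl
∑-∸-range (suc j) = begin
  ∑[ s ∈ range (suc j) ] (suc j ∸ s)
    ≡⟨ cong (λ xs → ∑[ s ∈ xs ] (suc j ∸ s)) (range-suc j) ⟩
  ∑[ s ∈ range j ++ [ suc j ] ] (suc j ∸ s)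
    ≡⟨ ∑-++ (range j) [ suc j ] (suc j ∸_) ⟩
  ∑[ s ∈ range j ] (suc j ∸ s) + (suc j ∸ suc j + 0)
    ≡⟨ cong (∑[ s ∈ range j ] (suc j ∸ s) +_) (cong (_+ 0) (n∸n≡0 j)) ⟩
  ∑[ s ∈ range j ] (suc j ∸ s) + 0
    ≡⟨ +-identityʳ _ ⟩
  ∑[ s ∈ range j ] (suc j ∸ s)
    ≡⟨ ∑-cong (range j) (λ s∈ → +-∸-assoc 1 (proj₂ (∈-range⁻ s∈))) ⟩
  ∑[ s ∈ range j ] (1 + (j ∸ s))
    ≡⟨ ∑-+ (range j) (λ _ → 1) (j ∸_) ⟩
  ∑[ s ∈ range j ] 1 + ∑[ s ∈ range j ] (j ∸ s)
    ≡⟨ cong₂ _+_ (trans (∑-one (range j)) (length-applyUpTo suc j)) (∑-∸-range j) ⟩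
  j + j choose 2
    ≡⟨ [1+n]C2≡n+nC2 j ⟨
  suc j choose 2 ∎
  where open ≡-Reasoning

module _ {j L : ℕ} (L≤j : L ≤ j) where

  private
    x : ℕ
    x = j + suc L

    R P : List ℕ
    R = range j
    P = R ++ [ x ]

    j<x : j < x
    j<x = m<m+n j (s≤s z≤n)

    ∈P⁻ : ∀ {t} → t ∈ P → (1 ≤ t × t ≤ j) ⊎ t ≡ x
    ∈P⁻ t∈ with ∈-++⁻ R t∈
    ... | inj₁ t∈R = inj₁ (∈-range⁻ t∈R)
    ... | inj₂ (here t≡x) = inj₂ t≡x

    1≤ : ∀ {t} → t ∈ P → 1 ≤ t
    1≤ t∈ with ∈P⁻ t∈
    ... | inj₁ (1≤t , _) = 1≤t
    ... | inj₂ refl = ≤-trans (s≤s z≤n) (m≤n+m (suc L) j)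

    above-x : ∀ {t} → x < t → t ∉ P
    above-x x<t t∈ with ∈P⁻ t∈
    ... | inj₁ (_ , t≤j) = <⇒≱ (<-trans j<x x<t) t≤j
    ... | inj₂ refl = <-irrefl refl x<t

    sums-x : sums P x ≡ 0
    sums-x = count-none _ P (λ s∈ → above-x (m<m+n x (1≤ s∈)))

    sums-range : ∀ {s} → s ∈ R → sums P s ≡ (j ∸ s) + count (λ s′ → s + s′ ≟ x) R
    sums-range {s} s∈ = begin
      count ∈P? (R ++ [ x ])
        ≡⟨ count-++ ∈P? R [ x ] ⟩
      count ∈P? R + count ∈P? [ x ]
        ≡⟨ cong₂ _+_ (count-split ∈P? ≤j? R) (count-∷-no ∈P? [] (above-x (m<n+m x 1≤s))) ⟩
      count (λ s′ → ∈P? s′ ×-dec ≤j? s′) R + count (λ s′ → ∈P? s′ ×-dec ¬? (≤j? s′)) R + 0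
        ≡⟨ cong₂ (λ a b → a + b + 0) (count-cong _ (_≤? j ∸ s) R (λ _ → mk⇔ (below ∘ proj₂) below⁻¹))
                                     (count-cong _ (λ s′ → s + s′ ≟ x) R (λ _ → mk⇔ hit hit⁻¹)) ⟩
      count (_≤? j ∸ s) R + count (λ s′ → s + s′ ≟ x) R + 0
        ≡⟨ +-identityʳ _ ⟩
      count (_≤? j ∸ s) R + count (λ s′ → s + s′ ≟ x) R
        ≡⟨ cong (_+ count (λ s′ → s + s′ ≟ x) R) (trans (count-range-≤ (j ∸ s) j) (m≥n⇒m⊓n≡n (m∸n≤m j s))) ⟩
      (j ∸ s) + count (λ s′ → s + s′ ≟ x) R ∎
      where
      open ≡-Reasoning
      ∈P? : ∀ s′ → Dec (s + s′ ∈ P)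
      ∈P? s′ = s + s′ ∈? P
      ≤j? : ∀ s′ → Dec (s + s′ ≤ j)
      ≤j? s′ = s + s′ ≤? j
      1≤s : 1 ≤ s
      1≤s = proj₁ (∈-range⁻ s∈)
      below : ∀ {s′} → s + s′ ≤ j → s′ ≤ j ∸ s
      below {s′} le = m+n≤o⇒m≤o∸n s′ (subst (_≤ j) (+-comm s s′) le)
      below⁻¹ : ∀ {s′} → s′ ≤ j ∸ s → s + s′ ∈ P × s + s′ ≤ j
      below⁻¹ {s′} le = ∈-++⁺ˡ (∈-range⁺ (≤-trans 1≤s (m≤m+n s s′)) s+s′≤j) , s+s′≤j
        where
        s+s′≤j : s + s′ ≤ j
        s+s′≤j = subst (_≤ j) (+-comm s′ s) (m≤o∸n⇒m+n≤o s′ (proj₂ (∈-range⁻ s∈)) le)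
      hit : ∀ {t} → t ∈ P × ¬ (t ≤ j) → t ≡ x
      hit (t∈ , t≰j) with ∈P⁻ t∈
      ... | inj₁ (_ , t≤j) = ⊥-elim (t≰j t≤j)
      ... | inj₂ t≡x = t≡x
      hit⁻¹ : ∀ {t} → t ≡ x → t ∈ P × ¬ (t ≤ j)
      hit⁻¹ refl = ∈-++⁺ʳ R (here refl) , <⇒≱ j<x

    pairs-summing-to-x : ∑[ s ∈ R ] count (λ s′ → s + s′ ≟ x) R ≡ j ∸ L
    pairs-summing-to-x = begin
      ∑[ s ∈ R ] count (λ s′ → s + s′ ≟ x) R
        ≡⟨ count-cartesianProduct (λ p → proj₁ p + proj₂ p ≟ x) R R ⟨
      count (λ p → proj₁ p + proj₂ p ≟ x) (cartesianProduct R R)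
        ≡⟨ count-bijection _ (L <?_) (Unique.cartesianProduct⁺ (range! j) (range! j)) (range! j)
             proj₁ (λ s → s , x ∸ s)
             (λ { {s , s′} ss′∈ s+s′≡x → let s∈ , s′∈ = ∈-cartesianProduct⁻ R R ss′∈ in
                  s∈ , +-cancelʳ-≤ s′ (suc L) s (subst (suc L + s′ ≤_) (sym s+s′≡x)
                         (subst (_≤ x) (+-comm s′ (suc L)) (+-monoˡ-≤ (suc L) (proj₂ (∈-range⁻ s′∈))))) })
             (λ {s} s∈ L<s → let _ , s≤j = ∈-range⁻ s∈ in
                  ∈-cartesianProduct⁺ s∈ (∈-range⁺ (m<n⇒0<n∸m (≤-<-trans s≤j j<x))
                    (subst (x ∸ s ≤_) (m+n∸n≡m j (suc L)) (∸-monoʳ-≤ x L<s))) ,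
                  m+[n∸m]≡n (<⇒≤ (≤-<-trans s≤j j<x)))
             (λ { {s , s′} _ s+s′≡x → cong (s ,_) (trans (cong (_∸ s) (sym s+s′≡x)) (m+n∸m≡n s s′)) })
             (λ _ _ → refl) ⟩
      count (L <?_) R
        ≡⟨ count-range-> L≤j ⟩
      j ∸ L ∎
      where open ≡-Reasoning

  schurTriples-range-∷ʳ : schurTriples (range j ++ [ j + suc L ]) ≡ j choose 2 + (j ∸ L)
  schurTriples-range-∷ʳ = begin
    ∑[ s ∈ R ++ [ x ] ] sums P s
      ≡⟨ ∑-++ R [ x ] (sums P) ⟩
    ∑[ s ∈ R ] sums P s + (sums P x + 0)
      ≡⟨ cong₂ _+_ (∑-cong R sums-range) (cong (_+ 0) sums-x) ⟩
    ∑[ s ∈ R ] ((j ∸ s) + count (λ s′ → s + s′ ≟ x) R) + 0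
      ≡⟨ +-identityʳ _ ⟩
    ∑[ s ∈ R ] ((j ∸ s) + count (λ s′ → s + s′ ≟ x) R)
      ≡⟨ ∑-+ R (j ∸_) (λ s → count (λ s′ → s + s′ ≟ x) R) ⟩
    ∑[ s ∈ R ] (j ∸ s) + ∑[ s ∈ R ] count (λ s′ → s + s′ ≟ x) R
      ≡⟨ cong₂ _+_ (∑-∸-range j) pairs-summing-to-x ⟩
    j choose 2 + (j ∸ L) ∎
    where open ≡-Reasoning

-- The circulant Circ(12B, {6B, 4B} ∪ U)

module Construction (B : ℕ) .{{_ : NonZero B}} (U : List ℕ) (U! : Unique U)
                    (U-bounds : ∀ {u} → u ∈ U → 1 ≤ u × u < B) where

  n : ℕ
  n = 12 * B

  instance
    n≢0 : NonZero n
    n≢0 = m*n≢0 12 B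

  indices : List ℕ
  indices = 6 ∷ 4 ∷ 8 ∷ []

  S : List ℕ
  S = 6 * B ∷ 4 * B ∷ U

  specials : List ℕ
  specials = map (_* B) indices

  C : List ℕ
  C = specials ++ U ++ map (n ∸_) U

  private
    1≤B : 1 ≤ B
    1≤B = >-nonZero⁻¹ B

    1≤u : ∀ {u} → u ∈ U → 1 ≤ u
    1≤u = proj₁ ∘ U-bounds

    u<B : ∀ {u} → u ∈ U → u < B
    u<B = proj₂ ∘ U-bounds

    *B-mono-≤ : ∀ {q q′} → q ≤ q′ → q * B ≤ q′ * B
    *B-mono-≤ = *-monoˡ-≤ B

    *B-mono-< : ∀ {q q′} → q < q′ → q * B < q′ * B
    *B-mono-< = *-monoˡ-< B

    *B+r< : ∀ {q q′ r} → r < B → q < q′ → q * B + r < q′ * B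
    *B+r< {q} {r = r} r<B q<q′ =
      <-≤-trans (subst (q * B + r <_) (+-comm (q * B) B) (+-monoʳ-< (q * B) r<B)) (*B-mono-≤ q<q′)

    *B-+-∸ : ∀ {q m} → q ≤ m → q * B + (m ∸ q) * B ≡ m * B
    *B-+-∸ {q} {m} q≤m = trans (sym (*-distribʳ-+ B q (m ∸ q))) (cong (_* B) (m+[n∸m]≡n q≤m))

    n∸*B : ∀ q → n ∸ q * B ≡ (12 ∸ q) * B
    n∸*B q = sym (*-distribʳ-∸ B 12 q)

    n∸u≡ : ∀ {u} → u ≤ B → n ∸ u ≡ 11 * B + (B ∸ u)
    n∸u≡ {u} u≤B = trans (cong (_∸ u) (+-comm B (11 * B))) (+-∸-assoc (11 * B) u≤B)

    11B<n∸u : ∀ {u} → u ∈ U → 11 * B < n ∸ u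
    11B<n∸u {u} u∈ = subst (11 * B <_) (sym (n∸u≡ (<⇒≤ (u<B u∈)))) (m<m+n (11 * B) (m<n⇒0<n∸m (u<B u∈)))

    index-bounds : ∀ {q} → q ∈ indices → 4 ≤ q × q ≤ 8
    index-bounds (here refl) = m≤m+n 4 2 , m≤m+n 6 2
    index-bounds (there (here refl)) = ≤-refl , m≤m+n 4 4
    index-bounds (there (there (here refl))) = m≤m+n 4 4 , ≤-refl

  S-valid : ValidConnSet n S
  S-valid = (≤-trans 1≤B (m≤n*m B 6) , ≤-reflexive (sym (*-assoc 2 6 B)))
          ∷ (≤-trans 1≤B (m≤n*m B 4) , subst (_≤ n) (*-assoc 2 4 B) (*B-mono-≤ (m≤m+n 8 4)))
          ∷ All.tabulate (λ u∈ → 1≤u u∈ , ≤-trans (*-monoʳ-≤ 2 (<⇒≤ (u<B u∈))) (*B-mono-≤ (m≤m+n 2 10)))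

  open Circulant n S S-valid

  private
    n∸6B≡6B : n ∸ 6 * B ≡ 6 * B
    n∸6B≡6B = n∸*B 6

    n∸4B≡8B : n ∸ 4 * B ≡ 8 * B
    n∸4B≡8B = n∸*B 4

  pos∈C : ∀ {u} → u ∈ U → u ∈ C
  pos∈C = ∈-++⁺ʳ specials ∘ ∈-++⁺ˡ

  neg∈C : ∀ {u} → u ∈ U → n ∸ u ∈ C
  neg∈C = ∈-++⁺ʳ specials ∘ ∈-++⁺ʳ U ∘ ∈-map⁺ (n ∸_)

  conn⇒C : ∀ {d} → Conn n S d → d ∈ C
  conn⇒C (here (inj₁ refl)) = here refl
  conn⇒C (here (inj₂ d≡n∸6B)) = here (trans d≡n∸6B n∸6B≡6B)
  conn⇒C (there (here (inj₁ refl))) = there (here refl)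
  conn⇒C (there (here (inj₂ d≡n∸4B))) = there (there (here (trans d≡n∸4B n∸4B≡8B)))
  conn⇒C (there (there conn)) with find conn
  ... | u , u∈ , inj₁ refl = pos∈C u∈
  ... | u , u∈ , inj₂ refl = neg∈C u∈

  conn-pos : ∀ {u} → u ∈ U → Conn n S u
  conn-pos u∈ = there (there (Any.map inj₁ u∈))

  conn-special : ∀ {q} → q ∈ indices → Conn n S (q * B)
  conn-special (here refl) = here (inj₁ refl)
  conn-special (there (here refl)) = there (here (inj₁ refl))
  conn-special (there (there (here refl))) = there (here (inj₂ (sym n∸4B≡8B)))

  data Region (d : ℕ) : Set where
    special : ∀ {q} → q ∈ indices → d ≡ q * B → Region d
    pos     : d ∈ U → Region d
    neg     : ∀ {u} → u ∈ U → d ≡ n ∸ u → Region d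

  region : ∀ {d} → d ∈ C → Region d
  region d∈ with ∈-++⁻ specials d∈
  ... | inj₁ d∈specials = let q , q∈ , d≡qB = ∈-map⁻ (_* B) d∈specials in special q∈ d≡qB
  ... | inj₂ d∈± with ∈-++⁻ U d∈±
  ...   | inj₁ d∈U = pos d∈U
  ...   | inj₂ d∈-U = let u , u∈ , d≡n∸u = ∈-map⁻ (n ∸_) d∈-U in neg u∈ d≡n∸u

  C⇒conn : ∀ {d} → d ∈ C → Conn n S d
  C⇒conn d∈ with region d∈
  ... | special q∈ refl = conn-special q∈
  ... | pos u∈ = conn-pos u∈
  ... | neg u∈ refl = conn-neg (conn-pos u∈)

  conn-middle : ∀ {d} → B ≤ d → d ≤ 11 * B → Conn n S d → ∃[ q ] q ∈ indices × d ≡ q * B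
  conn-middle B≤d d≤11B conn with region (conn⇒C conn)
  ... | special q∈ d≡qB = _ , q∈ , d≡qB
  ... | pos d∈U = ⊥-elim (<⇒≱ (u<B d∈U) B≤d)
  ... | neg u∈ refl = ⊥-elim (<⇒≱ (11B<n∸u u∈) d≤11B)

  ¬conn-offMultiple : ∀ q {r} → 1 ≤ q → q ≤ 10 → 1 ≤ r → r < B → ¬ Conn n S (q * B + r)
  ¬conn-offMultiple q {r} 1≤q q≤10 1≤r r<B conn =
    let m , _ , eq = conn-middle B≤ ≤11B conn in m*n+r≢o*n q m 1≤r r<B eq
    where
    B≤ : B ≤ q * B + r
    B≤ = ≤-trans (≤-trans (≤-reflexive (sym (*-identityˡ B))) (*B-mono-≤ 1≤q)) (m≤m+n (q * B) r)
    ≤11B : q * B + r ≤ 11 * B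
    ≤11B = <⇒≤ (*B+r< r<B (s≤s q≤10))

  conn-multiple : ∀ {q} → q < 12 → Conn n S (q * B) → q ∈ indices
  conn-multiple {zero} _ conn = ⊥-elim (¬conn-0 conn)
  conn-multiple {suc q} q<12 conn =
    let m , m∈ , eq = conn-middle (m≤m+n B (q * B)) (*B-mono-≤ (≤-pred q<12)) conn
    in subst (_∈ indices) (sym (*-cancelʳ-≡ (suc q) m B eq)) m∈

  conn-small : ∀ {d} → d < 2 * B → Conn n S d ⇔ d ∈ U
  conn-small {d} d<2B = mk⇔ to conn-pos
    where
    to : Conn n S d → d ∈ U
    to conn with region (conn⇒C conn)
    ... | special q∈ refl = ⊥-elim (<⇒≱ d<2B (*B-mono-≤ (≤-trans (m≤m+n 2 2) (proj₁ (index-bounds q∈)))))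
    ... | pos d∈U = d∈U
    ... | neg u∈ refl = ⊥-elim (<⇒≱ (<-trans (*B-mono-< (m≤m+n 3 8)) (11B<n∸u u∈)) (<⇒≤ d<2B))

  conn-large : ∀ {e} → e < 2 * B → Conn n S (n ∸ e) ⇔ e ∈ U
  conn-large {e} e<2B = mk⇔
    (λ conn → Equivalence.to (conn-small e<2B) (subst (Conn n S) (m∸[m∸n]≡n e≤n) (conn-neg conn)))
    (conn-neg ∘ conn-pos)
    where
    e≤n : e ≤ n
    e≤n = <⇒≤ (<-≤-trans e<2B (*B-mono-≤ (m≤m+n 2 10)))

  conn-diff? : ∀ a b → Dec (Conn n S (diff a b))
  conn-diff? a b = conn? n S (diff a b)

  row : ℕ → List ℕ → ℕ
  row a = count (conn-diff? a)

  private
    u<n : ∀ {u} → u ∈ U → u < n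
    u<n u∈ = <-≤-trans (u<B u∈) (m≤m+n B (11 * B))

    n∸u<n : ∀ {u} → u ∈ U → n ∸ u < n
    n∸u<n u∈ = ∸-monoʳ-< (1≤u u∈) (<⇒≤ (u<n u∈))

    qB<n : ∀ {q} → q ∈ indices → q * B < n
    qB<n q∈ = *B-mono-< (s≤s (≤-trans (proj₂ (index-bounds q∈)) (m≤m+n 8 3)))

    2≤q : ∀ {q} → q ∈ indices → 2 ≤ q
    2≤q q∈ = ≤-trans (m≤m+n 2 2) (proj₁ (index-bounds q∈))

    q≤10 : ∀ {q} → q ∈ indices → q ≤ 10
    q≤10 q∈ = ≤-trans (proj₂ (index-bounds q∈)) (m≤m+n 8 2)

    co-bounds : ∀ {u} → u ∈ U → 1 ≤ B ∸ u × B ∸ u < B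
    co-bounds u∈ = m<n⇒0<n∸m (u<B u∈) , ∸-monoʳ-< (1≤u u∈) (<⇒≤ (u<B u∈))

    ¬conn-diff : ∀ {x y} q {r} → x < n → y < n → 1 ≤ q × q ≤ 10 → 1 ≤ r × r < B →
      PlusModℕ n x (q * B + r) y → ¬ Conn n S (diff x y)
    ¬conn-diff q x<n y<n (1≤q , q≤10) (1≤r , r<B) x+d≡y conn = ¬conn-offMultiple q 1≤q q≤10 1≤r r<B
      (subst (Conn n S) (plusMod⇒diff x<n y<n (*B+r< r<B (s≤s (≤-trans q≤10 (m≤m+n 10 1)))) x+d≡y) conn)

  diff-multiples : ∀ q q′ → diff (q * B) (q′ * B) ≡ (12 ∸ q + q′) % 12 * B
  diff-multiples q q′ = begin
    (n ∸ q * B + q′ * B) % n      ≡⟨ cong (λ z → (z + q′ * B) % n) (n∸*B q) ⟩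
    ((12 ∸ q) * B + q′ * B) % n   ≡⟨ cong (_% n) (sym (*-distribʳ-+ B (12 ∸ q) q′)) ⟩
    (12 ∸ q + q′) * B % n         ≡⟨ m%n*o≡m*o%[n*o] (12 ∸ q + q′) 12 B ⟨
    (12 ∸ q + q′) % 12 * B        ∎
    where open ≡-Reasoning

  ¬conn-special-pos : ∀ {q u} → q ∈ indices → u ∈ U → ¬ Conn n S (diff (q * B) u)
  ¬conn-special-pos {q} {u} q∈ u∈ = ¬conn-diff (12 ∸ q) (qB<n q∈) (u<n u∈) q′-bounds (U-bounds u∈) (inj₂ (begin
      q * B + ((12 ∸ q) * B + u) ≡⟨ +-assoc (q * B) _ u ⟨
      q * B + (12 ∸ q) * B + u   ≡⟨ cong (_+ u) (*B-+-∸ (≤-trans (q≤10 q∈) (m≤m+n 10 2))) ⟩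
      n + u                      ≡⟨ +-comm n u ⟩
      u + n                      ∎))
    where
    open ≡-Reasoning
    q′-bounds : 1 ≤ 12 ∸ q × 12 ∸ q ≤ 10
    q′-bounds = m<n⇒0<n∸m (<-≤-trans (s≤s (q≤10 q∈)) (m≤m+n 11 1)) , ∸-monoʳ-≤ 12 (2≤q q∈)

  ¬conn-special-neg : ∀ {q u} → q ∈ indices → u ∈ U → ¬ Conn n S (diff (q * B) (n ∸ u))
  ¬conn-special-neg {q} {u} q∈ u∈ = ¬conn-diff (11 ∸ q) (qB<n q∈) (n∸u<n u∈) q′-bounds (co-bounds u∈) (inj₁ (begin
      q * B + ((11 ∸ q) * B + (B ∸ u)) ≡⟨ +-assoc (q * B) _ (B ∸ u) ⟨
      q * B + (11 ∸ q) * B + (B ∸ u)   ≡⟨ cong (_+ (B ∸ u)) (*B-+-∸ (≤-trans (q≤10 q∈) (m≤m+n 10 1))) ⟩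
      11 * B + (B ∸ u)                 ≡⟨ n∸u≡ (<⇒≤ (u<B u∈)) ⟨
      n ∸ u                            ∎))
    where
    open ≡-Reasoning
    q′-bounds : 1 ≤ 11 ∸ q × 11 ∸ q ≤ 10
    q′-bounds = m<n⇒0<n∸m (s≤s (q≤10 q∈)) , ∸-monoʳ-≤ 11 (≤-trans (s≤s z≤n) (2≤q q∈))

  ¬conn-pos-special : ∀ {q u} → q ∈ indices → u ∈ U → ¬ Conn n S (diff u (q * B))
  ¬conn-pos-special {q} {u} q∈ u∈ = ¬conn-diff (pred q) (u<n u∈) (qB<n q∈) q′-bounds (co-bounds u∈) (inj₁ (begin
      u + (pred q * B + (B ∸ u)) ≡⟨ x∙yz≈y∙xz u (pred q * B) (B ∸ u) ⟩
      pred q * B + (u + (B ∸ u)) ≡⟨ cong (pred q * B +_) (m+[n∸m]≡n (<⇒≤ (u<B u∈))) ⟩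
      pred q * B + B             ≡⟨ +-comm (pred q * B) B ⟩
      suc (pred q) * B           ≡⟨ cong (_* B) (suc-pred q {{>-nonZero (≤-trans (s≤s z≤n) (2≤q q∈))}}) ⟩
      q * B                      ∎))
    where
    open ≡-Reasoning
    q′-bounds : 1 ≤ pred q × pred q ≤ 10
    q′-bounds = pred-mono-≤ (2≤q q∈) , ≤-trans (pred-mono-≤ (q≤10 q∈)) (m≤m+n 9 1)

  ¬conn-neg-special : ∀ {q u} → q ∈ indices → u ∈ U → ¬ Conn n S (diff (n ∸ u) (q * B))
  ¬conn-neg-special {q} {u} q∈ u∈ =
    ¬conn-diff q (n∸u<n u∈) (qB<n q∈) (≤-trans (s≤s z≤n) (2≤q q∈) , q≤10 q∈) (U-bounds u∈) (inj₂ (begin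
      n ∸ u + (q * B + u) ≡⟨ x∙yz≈y∙xz (n ∸ u) (q * B) u ⟩
      q * B + (n ∸ u + u) ≡⟨ cong (q * B +_) (m∸n+n≡m (<⇒≤ (u<n u∈))) ⟩
      q * B + n           ∎))
    where open ≡-Reasoning

  private
    <B⇒<2B : ∀ {d} → d < B → d < 2 * B
    <B⇒<2B {d} d<B = <-≤-trans d<B (m≤m+n B (B + 0))

    u+w<2B : ∀ {u w} → u ∈ U → w ∈ U → u + w < 2 * B
    u+w<2B {u} {w} u∈ w∈ = subst (u + w <_) (cong (B +_) (sym (+-identityʳ B))) (+-mono-< (u<B u∈) (u<B w∈))

    2B≤n : 2 * B ≤ n
    2B≤n = *B-mono-≤ (m≤m+n 2 10)

    w≤n∸u : ∀ {u w} → u ∈ U → w ∈ U → w ≤ n ∸ u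
    w≤n∸u {u} {w} u∈ w∈ = m+n≤o⇒m≤o∸n w (subst (_≤ n) (+-comm u w) (<⇒≤ (<-≤-trans (u+w<2B u∈ w∈) 2B≤n)))

    n∸[u+w]≡ : ∀ u w → n ∸ (u + w) ≡ n ∸ w ∸ u
    n∸[u+w]≡ u w = trans (cong (n ∸_) (+-comm u w)) (sym (∸-+-assoc n w u))

  conn-diff-pos-pos : ∀ {u w} → u ∈ U → w ∈ U → Conn n S (diff u w) ⇔ ∣ u - w ∣ ∈ U
  conn-diff-pos-pos {u} {w} u∈ w∈ with u ≤? w
  ... | yes u≤w = subst₂ (λ d e → Conn n S d ⇔ e ∈ U) (sym diff≡) (sym (m≤n⇒∣m-n∣≡n∸m u≤w))
                     (conn-small (<B⇒<2B (≤-<-trans (m∸n≤m w u) (u<B w∈))))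
    where
    diff≡ : diff u w ≡ w ∸ u
    diff≡ = plusMod⇒diff (u<n u∈) (u<n w∈) (≤-<-trans (m∸n≤m w u) (u<n w∈)) (inj₁ (m+[n∸m]≡n u≤w))
  ... | no u≰w = subst₂ (λ d e → Conn n S d ⇔ e ∈ U) (sym diff≡) (sym (m≤n⇒∣n-m∣≡n∸m w≤u))
                    (conn-large u∸w<2B)
    where
    w≤u : w ≤ u
    w≤u = ≰⇒≥ u≰w
    u∸w<2B : u ∸ w < 2 * B
    u∸w<2B = <B⇒<2B (≤-<-trans (m∸n≤m u w) (u<B u∈))
    u∸w≤n : u ∸ w ≤ n
    u∸w≤n = <⇒≤ (<-≤-trans u∸w<2B 2B≤n)
    diff≡ : diff u w ≡ n ∸ (u ∸ w)
    diff≡ = plusMod⇒diff (u<n u∈) (u<n w∈) (∸-monoʳ-< (m<n⇒0<n∸m (≰⇒> u≰w)) u∸w≤n) (inj₂ (begin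
        u + (n ∸ (u ∸ w))           ≡⟨ cong (_+ (n ∸ (u ∸ w))) (trans (sym (m∸n+n≡m w≤u)) (+-comm (u ∸ w) w)) ⟩
        w + (u ∸ w) + (n ∸ (u ∸ w)) ≡⟨ +-assoc w (u ∸ w) _ ⟩
        w + ((u ∸ w) + (n ∸ (u ∸ w))) ≡⟨ cong (w +_) (m+[n∸m]≡n u∸w≤n) ⟩
        w + n                       ∎))
      where open ≡-Reasoning

  diff-neg-neg : ∀ {u w} → u ∈ U → w ∈ U → diff (n ∸ u) (n ∸ w) ≡ diff w u
  diff-neg-neg {u} {w} u∈ w∈ = begin
    diff (n ∸ u) (n ∸ w)    ≡⟨ cong₂ diff (shift u∈ w∈) (trans (cong (λ z → (n ∸ z + u) % n) (+-comm u w)) (shift w∈ u∈)) ⟨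
    diff (v +ₙ w) (v +ₙ u)  ≡⟨ diff-translate v (<⇒≤ (u<n w∈)) (u<n u∈) ⟩
    diff w u                ∎
    where
    open ≡-Reasoning
    v : ℕ
    v = n ∸ (u + w)
    shift : ∀ {a b} → a ∈ U → b ∈ U → (n ∸ (a + b)) +ₙ b ≡ n ∸ a
    shift {a} {b} a∈ b∈ = begin
      (n ∸ (a + b) + b) % n ≡⟨ cong (λ z → (z + b) % n) (∸-+-assoc n a b) ⟨
      (n ∸ a ∸ b + b) % n   ≡⟨ cong (_% n) (m∸n+n≡m (w≤n∸u a∈ b∈)) ⟩
      (n ∸ a) % n           ≡⟨ m<n⇒m%n≡m (n∸u<n a∈) ⟩
      n ∸ a                 ∎

  conn-diff-neg-neg : ∀ {u w} → u ∈ U → w ∈ U → Conn n S (diff (n ∸ u) (n ∸ w)) ⇔ ∣ u - w ∣ ∈ U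
  conn-diff-neg-neg {u} {w} u∈ w∈ =
    subst₂ (λ d e → Conn n S d ⇔ e ∈ U) (sym (diff-neg-neg u∈ w∈)) (∣-∣-comm w u) (conn-diff-pos-pos w∈ u∈)

  conn-diff-pos-neg : ∀ {u w} → u ∈ U → w ∈ U → Conn n S (diff u (n ∸ w)) ⇔ u + w ∈ U
  conn-diff-pos-neg {u} {w} u∈ w∈ =
    subst (λ d → Conn n S d ⇔ u + w ∈ U) (sym diff≡) (conn-large (u+w<2B u∈ w∈))
    where
    n∸[u+w]<n : n ∸ (u + w) < n
    n∸[u+w]<n = ∸-monoʳ-< (≤-trans (1≤u u∈) (m≤m+n u w)) (<⇒≤ (<-≤-trans (u+w<2B u∈ w∈) 2B≤n))
    diff≡ : diff u (n ∸ w) ≡ n ∸ (u + w)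
    diff≡ = plusMod⇒diff (u<n u∈) (n∸u<n w∈) n∸[u+w]<n
      (inj₁ (trans (cong (u +_) (n∸[u+w]≡ u w)) (m+[n∸m]≡n (w≤n∸u w∈ u∈))))

  conn-diff-neg-pos : ∀ {u w} → u ∈ U → w ∈ U → Conn n S (diff (n ∸ u) w) ⇔ u + w ∈ U
  conn-diff-neg-pos {u} {w} u∈ w∈ =
    subst (λ d → Conn n S d ⇔ u + w ∈ U) (sym diff≡) (conn-small (u+w<2B u∈ w∈))
    where
    diff≡ : diff (n ∸ u) w ≡ u + w
    diff≡ = plusMod⇒diff (n∸u<n u∈) (u<n w∈) (<-≤-trans (u+w<2B u∈ w∈) 2B≤n) (inj₂ (begin
      n ∸ u + (u + w) ≡⟨ +-assoc (n ∸ u) u w ⟨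
      n ∸ u + u + w   ≡⟨ cong (_+ w) (m∸n+n≡m (<⇒≤ (u<n u∈))) ⟩
      n + w           ≡⟨ +-comm n w ⟩
      w + n           ∎))
      where open ≡-Reasoning

  private
    row-++ : ∀ a → row a C ≡ row a specials + (row a U + row a (map (n ∸_) U))
    row-++ a = trans (count-++ (conn-diff? a) specials (U ++ map (n ∸_) U))
                     (cong (row a specials +_) (count-++ (conn-diff? a) U (map (n ∸_) U)))

    row-neg≡ : ∀ a → row a (map (n ∸_) U) ≡ count (λ w → conn-diff? a (n ∸ w)) U
    row-neg≡ a = count-map (conn-diff? a) (n ∸_) U

    row-specials≡ : ∀ a → row a specials ≡ count (λ q → conn-diff? a (q * B)) indices
    row-specials≡ a = count-map (conn-diff? a) (_* B) indices

  row-special : ∀ {q} → q ∈ indices →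
    row (q * B) C ≡ count (λ q′ → (12 ∸ q + q′) % 12 ∈? indices) indices
  row-special {q} q∈ = begin
    row (q * B) C
      ≡⟨ row-++ (q * B) ⟩
    row (q * B) specials + (row (q * B) U + row (q * B) (map (n ∸_) U))
      ≡⟨ cong₂ (λ x y → row (q * B) specials + (x + y))
           (count-none (conn-diff? (q * B)) U (¬conn-special-pos q∈))
           (trans (row-neg≡ (q * B))
                  (count-none (λ w → conn-diff? (q * B) (n ∸ w)) U (¬conn-special-neg q∈))) ⟩
    row (q * B) specials + 0
      ≡⟨ +-identityʳ _ ⟩
    row (q * B) specials
      ≡⟨ row-specials≡ (q * B) ⟩
    count (λ q′ → conn-diff? (q * B) (q′ * B)) indices
      ≡⟨ count-cong (λ q′ → conn-diff? (q * B) (q′ * B)) (λ q′ → (12 ∸ q + q′) % 12 ∈? indices) indices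
                    (λ {q′} _ → conn-diff-multiples q′) ⟩
    count (λ q′ → (12 ∸ q + q′) % 12 ∈? indices) indices ∎
    where
    open ≡-Reasoning
    conn-diff-multiples : ∀ q′ → Conn n S (diff (q * B) (q′ * B)) ⇔ (12 ∸ q + q′) % 12 ∈ indices
    conn-diff-multiples q′ =
      subst (λ d → Conn n S d ⇔ (12 ∸ q + q′) % 12 ∈ indices) (sym (diff-multiples q q′))
        (mk⇔ (conn-multiple (m%n<n (12 ∸ q + q′) 12)) conn-special)

  row-pos : ∀ {u} → u ∈ U → row u C ≡ dists U u + sums U u
  row-pos {u} u∈ = begin
    row u C
      ≡⟨ row-++ u ⟩
    row u specials + (row u U + row u (map (n ∸_) U))
      ≡⟨ cong₂ _+_ specials-part (cong₂ _+_ pos-part (trans (row-neg≡ u) neg-part)) ⟩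
    0 + (dists U u + sums U u) ∎
    where
    open ≡-Reasoning
    specials-part : row u specials ≡ 0
    specials-part = trans (row-specials≡ u)
      (count-none (λ q → conn-diff? u (q * B)) indices (λ q∈ → ¬conn-pos-special q∈ u∈))
    pos-part : row u U ≡ dists U u
    pos-part = count-cong (conn-diff? u) (λ w → ∣ u - w ∣ ∈? U) U (conn-diff-pos-pos u∈)
    neg-part : count (λ w → conn-diff? u (n ∸ w)) U ≡ sums U u
    neg-part = count-cong (λ w → conn-diff? u (n ∸ w)) (λ w → u + w ∈? U) U (conn-diff-pos-neg u∈)

  row-neg : ∀ {u} → u ∈ U → row (n ∸ u) C ≡ sums U u + dists U u
  row-neg {u} u∈ = begin
    row (n ∸ u) C
      ≡⟨ row-++ (n ∸ u) ⟩
    row (n ∸ u) specials + (row (n ∸ u) U + row (n ∸ u) (map (n ∸_) U))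
      ≡⟨ cong₂ _+_ specials-part (cong₂ _+_ pos-part (trans (row-neg≡ (n ∸ u)) neg-part)) ⟩
    0 + (sums U u + dists U u) ∎
    where
    open ≡-Reasoning
    specials-part : row (n ∸ u) specials ≡ 0
    specials-part = trans (row-specials≡ (n ∸ u))
      (count-none (λ q → conn-diff? (n ∸ u) (q * B)) indices (λ q∈ → ¬conn-neg-special q∈ u∈))
    pos-part : row (n ∸ u) U ≡ sums U u
    pos-part = count-cong (conn-diff? (n ∸ u)) (λ w → u + w ∈? U) U (conn-diff-neg-pos u∈)
    neg-part : count (λ w → conn-diff? (n ∸ u) (n ∸ w)) U ≡ dists U u
    neg-part = count-cong (λ w → conn-diff? (n ∸ u) (n ∸ w)) (λ w → ∣ u - w ∣ ∈? U) U (conn-diff-neg-neg u∈)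

  ∑-rows : ∑[ a ∈ C ] row a C ≡ 2 * (1 + 3 * schurTriples U)
  ∑-rows = begin
    ∑[ a ∈ C ] row a C
      ≡⟨ ∑-++ specials (U ++ map (n ∸_) U) rowC ⟩
    ∑ specials rowC + ∑ (U ++ map (n ∸_) U) rowC
      ≡⟨ cong (∑ specials rowC +_) (∑-++ U (map (n ∸_) U) rowC) ⟩
    ∑ specials rowC + (∑ U rowC + ∑ (map (n ∸_) U) rowC)
      ≡⟨ cong₂ (λ x y → x + (∑ U rowC + y)) (∑-map (_* B) indices rowC) (∑-map (n ∸_) U rowC) ⟩
    ∑[ q ∈ indices ] rowC (q * B) + (∑ U rowC + ∑[ u ∈ U ] rowC (n ∸ u))
      ≡⟨ cong₂ _+_ (∑-cong indices row-special) (cong₂ _+_ (∑-cong U row-pos) (∑-cong U row-neg)) ⟩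
    ∑[ q ∈ indices ] count (λ q′ → (12 ∸ q + q′) % 12 ∈? indices) indices
      + (∑[ u ∈ U ] (dists U u + sums U u) + ∑[ u ∈ U ] (sums U u + dists U u))
      ≡⟨ cong₂ _+_ specials-total (cong₂ _+_ (∑-+ U (dists U) (sums U)) (∑-+ U (sums U) (dists U))) ⟩
    2 + ((∑[ u ∈ U ] dists U u + σ) + (σ + ∑[ u ∈ U ] dists U u))
      ≡⟨ cong (λ x → 2 + ((x + σ) + (σ + x))) (∑-dists U! 1≤u) ⟩
    2 + ((σ + σ + σ) + (σ + (σ + σ)))
      ≡⟨ arithmetic σ ⟩
    2 * (1 + 3 * σ) ∎
    where
    open ≡-Reasoning
    rowC : ℕ → ℕ
    rowC a = row a C
    σ : ℕ
    σ = schurTriples U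
    specials-total : ∑[ q ∈ indices ] count (λ q′ → (12 ∸ q + q′) % 12 ∈? indices) indices ≡ 2
    specials-total = refl
    arithmetic : ∀ σ → 2 + ((σ + σ + σ) + (σ + (σ + σ))) ≡ 2 * (1 + 3 * σ)
    arithmetic = solve-∀

  C<n : ∀ {d} → d ∈ C → d < n
  C<n d∈ with region d∈
  ... | special q∈ refl = qB<n q∈
  ... | pos u∈ = u<n u∈
  ... | neg u∈ refl = n∸u<n u∈

  C! : Unique C
  C! = Unique.++⁺ specials! (Unique.++⁺ U! -U! U∩-U) specials∩±U
    where
    indices! : Unique indices
    indices! = ((λ ()) ∷ (λ ()) ∷ []) ∷ ((λ ()) ∷ []) ∷ [] ∷ []
    specials! : Unique specials
    specials! = Unique.map⁺ (λ {q} {q′} → *-cancelʳ-≡ q q′ B) indices!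
    -U! : Unique (map (n ∸_) U)
    -U! = Unique-map⁺ (n ∸_) (n ∸_) (λ u∈ → m∸[m∸n]≡n (<⇒≤ (u<n u∈))) U!
    B≤11B : B ≤ 11 * B
    B≤11B = m≤m+n B (10 * B)
    U∩-U : ∀ {d} → ¬ (d ∈ U × d ∈ map (n ∸_) U)
    U∩-U (d∈U , d∈-U) with ∈-map⁻ (n ∸_) d∈-U
    ... | w , w∈ , refl = <⇒≱ (u<B d∈U) (≤-trans B≤11B (<⇒≤ (11B<n∸u w∈)))
    specials∩±U : ∀ {d} → ¬ (d ∈ specials × d ∈ U ++ map (n ∸_) U)
    specials∩±U (d∈specials , d∈±U) with ∈-map⁻ (_* B) {xs = indices} d∈specials
    ... | q , q∈ , refl with ∈-++⁻ U d∈±U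
    ...   | inj₁ d∈U = <⇒≱ (u<B d∈U) (≤-trans (m≤m+n B (3 * B)) (*B-mono-≤ (proj₁ (index-bounds q∈))))
    ...   | inj₂ d∈-U with ∈-map⁻ (n ∸_) d∈-U
    ...     | w , w∈ , qB≡n∸w = <⇒≢ (<-trans (*B-mono-< q<11) (11B<n∸u w∈)) qB≡n∸w
      where
      q<11 : q < 11
      q<11 = s≤s (≤-trans (proj₂ (index-bounds q∈)) (m≤m+n 8 2))

  length-C : length C ≡ 3 + 2 * length U
  length-C = cong (3 +_) (begin
    length (U ++ map (n ∸_) U)        ≡⟨ length-++ U ⟩
    length U + length (map (n ∸_) U)  ≡⟨ cong (length U +_) (length-map (n ∸_) U) ⟩
    length U + length U               ≡⟨ cong (length U +_) (+-identityʳ (length U)) ⟨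
    2 * length U                      ∎)
    where open ≡-Reasoning

  circulant : ExistsRCCirculant (3 + 2 * length U) (1 + 3 * schurTriples U)
  circulant = n , S , ≤-trans (m≤m+n 2 10) (m≤m*n 12 B) , S-valid ,
    subst (λ r → IsRCGraph r (1 + 3 * schurTriples U) n S) length-C
      (isRCGraph C C! C<n C⇒conn (λ _ → conn⇒C) (1 + 3 * schurTriples U) ∑-rows)

-- Sets with a prescribed number of Schur triples

module SchurSet (j L p : ℕ) (L≤j : L ≤ j) where

  Q : ℕ
  Q = 4 * suc p

  instance
    Q≢0 : NonZero Q
    Q≢0 = m*n≢0 4 (suc p)

  x : ℕ
  x = j + suc L

  P : List ℕ
  P = range j ++ [ x ]

  padding : List ℕ
  padding = applyUpTo (suc p +_) p

  U : List ℕ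
  U = padding ++ map (Q *_) P

  bound : ℕ
  bound = Q * suc x

  private
    P-bounds : ∀ {s} → s ∈ P → 1 ≤ s × s ≤ x
    P-bounds s∈ with ∈-++⁻ (range j) s∈
    ... | inj₁ s∈R = let 1≤s , s≤j = ∈-range⁻ s∈R in 1≤s , ≤-trans s≤j (m≤m+n j (suc L))
    ... | inj₂ (here refl) = ≤-trans (s≤s z≤n) (m≤n+m (suc L) j) , ≤-refl

    padding-bounds : ∀ {g} → g ∈ padding → suc p ≤ g × g ≤ p + p
    padding-bounds g∈ with ∈-applyUpTo⁻ (suc p +_) g∈
    ... | t , t<p , refl = m≤m+n (suc p) t , +-monoʳ-< p t<p

    4p<Q : p + p + (p + p) < Q
    4p<Q = subst (p + p + (p + p) <_) (sym (4[1+p] p)) (m≤m+n (suc (p + p + (p + p))) 3)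
      where
      4[1+p] : ∀ p → 4 * suc p ≡ suc (p + p + (p + p)) + 3
      4[1+p] = solve-∀

    p+p<Q : p + p < Q
    p+p<Q = ≤-<-trans (m≤m+n (p + p) (p + p)) 4p<Q

    Q≤Q* : ∀ {s} → 1 ≤ s → Q ≤ Q * s
    Q≤Q* {s} 1≤s = subst (_≤ Q * s) (*-identityʳ Q) (*-monoʳ-≤ Q 1≤s)

    padding<Q : ∀ {g} → g ∈ padding → g < Q
    padding<Q g∈ = ≤-<-trans (proj₂ (padding-bounds g∈)) p+p<Q

    padding<Q* : ∀ {g s} → g ∈ padding → 1 ≤ s → g < Q * s
    padding<Q* g∈ 1≤s = <-≤-trans (padding<Q g∈) (Q≤Q* 1≤s)

    p<U : ∀ {u} → u ∈ U → p < u
    p<U u∈ with ∈-++⁻ padding u∈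
    ... | inj₁ g∈ = proj₁ (padding-bounds g∈)
    ... | inj₂ v∈ with ∈-map⁻ (Q *_) v∈
    ...   | s , s∈ , refl = <-≤-trans (≤-<-trans (m≤m+n p p) p+p<Q) (Q≤Q* (proj₁ (P-bounds s∈)))

    isolated : ∀ {g y} → g ∈ padding → y ∈ U → g + y ∉ U
    isolated {g} {y} g∈ y∈ g+y∈ with ∈-++⁻ padding g+y∈
    ... | inj₁ g+y∈padding =
          <⇒≱ (+-mono-< (proj₁ (padding-bounds g∈)) (p<U y∈)) (proj₂ (padding-bounds g+y∈padding))
    ... | inj₂ g+y∈Q*P with ∈-map⁻ (Q *_) g+y∈Q*P | ∈-++⁻ padding y∈
    ...   | s′ , s′∈ , g+y≡Qs′ | inj₁ y∈padding = <⇒≢ g+y<Qs′ g+y≡Qs′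
      where
      g+y<Qs′ : g + y < Q * s′
      g+y<Qs′ = ≤-<-trans (+-mono-≤ (proj₂ (padding-bounds g∈)) (proj₂ (padding-bounds y∈padding)))
                          (<-≤-trans 4p<Q (Q≤Q* (proj₁ (P-bounds s′∈))))
    ...   | s′ , _ , g+y≡Qs′ | inj₂ y∈Q*P with ∈-map⁻ (Q *_) y∈Q*P
    ...     | s , _ , refl = m*n+r≢o*n s s′ (≤-trans (s≤s z≤n) (proj₁ (padding-bounds g∈))) (padding<Q g∈)
      (begin
        s * Q + g   ≡⟨ +-comm (s * Q) g ⟩
        g + s * Q   ≡⟨ cong (g +_) (*-comm s Q) ⟩
        g + Q * s   ≡⟨ g+y≡Qs′ ⟩
        Q * s′      ≡⟨ *-comm Q s′ ⟩
        s′ * Q      ∎)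
      where open ≡-Reasoning

    sums∉padding : ∀ {v w} → v ∈ map (Q *_) P → w ∈ map (Q *_) P → v + w ∉ padding
    sums∉padding {v} {w} v∈ w∈ v+w∈ with ∈-map⁻ (Q *_) v∈
    ... | s , s∈ , refl = <⇒≱ (padding<Q* v+w∈ (proj₁ (P-bounds s∈))) (m≤m+n (Q * s) w)

    P! : Unique P
    P! = Unique.++⁺ (range! j) ([] ∷ [])
      (λ { (t∈R , here refl) → <⇒≱ (m<m+n j (s≤s z≤n)) (proj₂ (∈-range⁻ t∈R)) })

  U! : Unique U
  U! = Unique.++⁺ (Unique.applyUpTo⁺₁ (suc p +_) p (λ i<k _ eq → <⇒≢ i<k (+-cancelˡ-≡ (suc p) _ _ eq)))
                  (Unique.map⁺ (λ {s} {s′} → *-cancelˡ-≡ s s′ Q) P!)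
                  (λ (g∈ , v∈) → let s , s∈ , g≡Qs = ∈-map⁻ (Q *_) v∈ in
                     <⇒≢ (padding<Q* g∈ (proj₁ (P-bounds s∈))) g≡Qs)

  U-bounds : ∀ {u} → u ∈ U → 1 ≤ u × u < bound
  U-bounds u∈ with ∈-++⁻ padding u∈
  ... | inj₁ g∈ = ≤-trans (s≤s z≤n) (proj₁ (padding-bounds g∈)) , padding<Q* g∈ (s≤s z≤n)
  ... | inj₂ v∈ with ∈-map⁻ (Q *_) v∈
  ...   | s , s∈ , refl = ≤-trans (s≤s z≤n) (p<U u∈) , *-monoʳ-< Q (s≤s (proj₂ (P-bounds s∈)))

  length-U : length U ≡ p + suc j
  length-U = begin
    length (padding ++ map (Q *_) P)
      ≡⟨ length-++ padding ⟩
    length padding + length (map (Q *_) P)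
      ≡⟨ cong₂ _+_ (length-applyUpTo (suc p +_) p) (length-map (Q *_) P) ⟩
    p + length (range j ++ [ x ])
      ≡⟨ cong (p +_) (trans (length-++ (range j)) (cong (_+ 1) (length-applyUpTo suc j))) ⟩
    p + (j + 1)
      ≡⟨ cong (p +_) (+-comm j 1) ⟩
    p + suc j ∎
    where open ≡-Reasoning

  schurTriples-U : schurTriples U ≡ j choose 2 + (j ∸ L)
  schurTriples-U = begin
    schurTriples (padding ++ map (Q *_) P) ≡⟨ schurTriples-padding isolated sums∉padding ⟩
    schurTriples (map (Q *_) P)            ≡⟨ schurTriples-scale Q P ⟩
    schurTriples P                         ≡⟨ schurTriples-range-∷ʳ L≤j ⟩
    j choose 2 + (j ∸ L)                   ∎
    where open ≡-Reasoning

circulant-for : ∀ j i p → i ≤ j → ExistsRCCirculant (3 + 2 * (p + suc j)) (1 + 3 * (j choose 2 + i))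
circulant-for j i p i≤j = subst₂ ExistsRCCirculant
  (cong (λ m → 3 + 2 * m) length-U)
  (cong (λ σ → 1 + 3 * σ) (trans schurTriples-U (cong (j choose 2 +_) (m∸[m∸n]≡n i≤j))))
  (Construction.circulant bound U U! U-bounds)
  where
  open SchurSet j (j ∸ i) p (m∸n≤m j i)
  instance
    bound≢0 : NonZero bound
    bound≢0 = m*n≢0 Q (suc x)

-- The parameters j, i, p of (r, c)

2*nC2≡n*[n∸1] : ∀ j → 2 * (j choose 2) ≡ j * (j ∸ 1)
2*nC2≡n*[n∸1] zero = refl
2*nC2≡n*[n∸1] (suc j) = begin
  2 * (suc j choose 2)      ≡⟨ cong (2 *_) ([1+n]C2≡n+nC2 j) ⟩
  2 * (j + j choose 2)      ≡⟨ *-distribˡ-+ 2 j (j choose 2) ⟩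
  2 * j + 2 * (j choose 2)  ≡⟨ cong (2 * j +_) (2*nC2≡n*[n∸1] j) ⟩
  2 * j + j * (j ∸ 1)       ≡⟨ step j ⟩
  suc j * j                 ∎
  where
  open ≡-Reasoning
  step : ∀ j → 2 * j + j * (j ∸ 1) ≡ suc j * j
  step zero = refl
  step (suc j) = identity j
    where
    identity : ∀ j → 2 * suc j + suc j * j ≡ suc (suc j) * suc j
    identity = solve-∀

c-decomposition : ∀ j c → c % 3 ≡ 1 → 3 * ((j ∸ 1) * j) ≤ 2 * c → 2 * c ≤ 3 * (suc j * j) →
  ∃[ i ] i ≤ j × c ≡ 1 + 3 * (j choose 2 + i)
c-decomposition j c c%3≡1 lower upper = t ∸ T , i≤j , c≡
  where
  t T : ℕ
  t = c / 3
  T = j choose 2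
  c≡1+3t : c ≡ 1 + 3 * t
  c≡1+3t = trans (m≡m%n+[m/n]*n c 3) (cong₂ _+_ c%3≡1 (*-comm t 3))
  6T<6[1+t] : 6 * T < 6 * suc t
  6T<6[1+t] = begin-strict
    6 * T                  ≡⟨ *-assoc 3 2 T ⟩
    3 * (2 * T)            ≡⟨ cong (3 *_) (trans (2*nC2≡n*[n∸1] j) (*-comm j (j ∸ 1))) ⟩
    3 * ((j ∸ 1) * j)      ≤⟨ lower ⟩
    2 * c                  ≡⟨ cong (2 *_) c≡1+3t ⟩
    2 * (1 + 3 * t)        <⟨ m<m+n (2 * (1 + 3 * t)) {4} (s≤s z≤n) ⟩
    2 * (1 + 3 * t) + 4    ≡⟨ identity t ⟩
    6 * suc t              ∎
    where
    open ≤-Reasoning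
    identity : ∀ t → 2 * (1 + 3 * t) + 4 ≡ 6 * suc t
    identity = solve-∀
  6t<6[T+j] : 6 * t < 6 * (T + j)
  6t<6[T+j] = begin-strict
    6 * t                  <⟨ m<m+n (6 * t) {2} (s≤s z≤n) ⟩
    6 * t + 2              ≡⟨ identity t ⟩
    2 * (1 + 3 * t)        ≡⟨ cong (2 *_) c≡1+3t ⟨
    2 * c                  ≤⟨ upper ⟩
    3 * (suc j * j)        ≡⟨ cong (3 *_) (2*nC2≡n*[n∸1] (suc j)) ⟨
    3 * (2 * (suc j choose 2)) ≡⟨ cong (λ m → 3 * (2 * m)) ([1+n]C2≡n+nC2 j) ⟩
    3 * (2 * (j + T))      ≡⟨ identity₂ j T ⟩
    6 * (T + j)            ∎
    where
    open ≤-Reasoning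
    identity : ∀ t → 6 * t + 2 ≡ 2 * (1 + 3 * t)
    identity = solve-∀
    identity₂ : ∀ j T → 3 * (2 * (j + T)) ≡ 6 * (T + j)
    identity₂ = solve-∀
  T≤t : T ≤ t
  T≤t = ≤-pred (*-cancelˡ-< 6 T (suc t) 6T<6[1+t])
  i≤j : t ∸ T ≤ j
  i≤j = <⇒≤ (subst (t ∸ T <_) (m+n∸m≡n T j) (∸-monoˡ-< (*-cancelˡ-< 6 t (T + j) 6t<6[T+j]) T≤t))
  c≡ : c ≡ 1 + 3 * (T + (t ∸ T))
  c≡ = trans c≡1+3t (cong (λ m → 1 + 3 * m) (sym (m+[n∸m]≡n T≤t)))

r-decomposition : ∀ k r → r % 2 ≡ 1 → 2 * k + 3 ≤ r → ∃[ p ] r ≡ 3 + 2 * (p + k)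
r-decomposition k r r%2≡1 2k+3≤r = h ∸ suc k , r≡
  where
  h : ℕ
  h = r / 2
  r≡1+2h : r ≡ 1 + 2 * h
  r≡1+2h = trans (m≡m%n+[m/n]*n r 2) (cong₂ _+_ r%2≡1 (*-comm h 2))
  k<h : suc k ≤ h
  k<h = *-cancelˡ-≤ 2 (+-cancelˡ-≤ 1 _ _ (subst₂ _≤_ (identity k) r≡1+2h 2k+3≤r))
    where
    identity : ∀ k → 2 * k + 3 ≡ 1 + 2 * suc k
    identity = solve-∀
  r≡ : r ≡ 3 + 2 * (h ∸ suc k + k)
  r≡ = begin
    r                         ≡⟨ r≡1+2h ⟩
    1 + 2 * h                 ≡⟨ cong (λ m → 1 + 2 * m) (m∸n+n≡m k<h) ⟨
    1 + 2 * (h ∸ suc k + suc k) ≡⟨ identity (h ∸ suc k) k ⟩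
    3 + 2 * (h ∸ suc k + k)   ∎
    where
    open ≡-Reasoning
    identity : ∀ p k → 1 + 2 * (p + suc k) ≡ 3 + 2 * (p + k)
    identity = solve-∀

proposition3p8 : (k c r : ℕ) → 1 ≤ k → 2 * k + 3 ≤ r → r % 2 ≡ 1 → c % 3 ≡ 1 →
    3 * ((k ∸ 2) * (k ∸ 1)) ≤ 2 * c → 2 * c ≤ 3 * (k * (k ∸ 1)) →
    ExistsRCCirculant r c
proposition3p8 zero _ _ () _ _ _ _ _
proposition3p8 (suc j) c r _ 2k+3≤r r%2≡1 c%3≡1 lower upper =
  let i , i≤j , c≡ = c-decomposition j c c%3≡1 lower upper
      p , r≡ = r-decomposition (suc j) r r%2≡1 2k+3≤r
  in subst₂ ExistsRCCirculant (sym r≡) (sym c≡) (circulant-for j i p i≤j)
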